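{- For all ordinary $\lambda$-terms $t,u$: $t\sqsubseteq_{\mathcal{B}\eta\mathrm{red}}u$ entails $t\sqsubseteq^{\mathrm{pwc}}u$.
   Context: $\sqsubseteq_{\mathcal{B}\eta\mathrm{red}}$ is the largest relation such that $t\sqsubseteq_{\mathcal{B}\eta\mathrm{red}}u$ implies either $t$ has no head normal form, or $t$ has head normal form $\lambda x_1\dots x_{n+p}.y\,t_1\cdots t_{k+p}$ and $u$ has head normal form $\lambda x_1\dots x_n.y\,u_1\cdots u_k$ with $p\ge0$, $y$ equally bound or free in both, $t_i\sqsubseteq_{\mathcal{B}\eta\mathrm{red}}u_i$ ($i\le k$), $t_i\sqsubseteq_{\mathcal{B}\eta\mathrm{red}}x_i$ ($k<i\le k+p$), $x_{k+1},\dots,x_{k+p}$ not free in $y\,u_1\cdots u_k$. Checkers terms $t ::= x\mid\lambda_cx.t\mid t\cdot^cu$, $c\in\{\circ,\bullet\}$; $t^\bullet$ paints the $\lambda$-term $t$ entirely black. Colored multi types: $L ::= X \mid M\to_c L$, $M=[L_1,\dots,L_n]$; rules: $x:[L]\vdash^0 x:L$; many: from $(\Gamma_i\vdash^{k_i} t:L_i)_{i\in I}$ infer $\uplus_i\Gamma_i\vdash^{\sum_i k_i} t:[L_i]_{i\in I}$; from $\Gamma,x:M\vdash^k t:L$ infer $\Gamma\vdash^k\lambda_c x.t: M\to_c L$; from $\Gamma\vdash^{k_1}t:M\to_c L$ and $\Delta\vdash^{k_2}u:M$ infer $\Gamma\uplus\Delta\vdash^{k}t\cdot^{d}u:L$,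 $k=k_1+k_2$ if $c=d$, else $k_1+k_2+1$. $[\![t]\!]=\{(\Gamma,L,k)\mid\Gamma\vdash^kt:L\}$. Polarized whitening $\le^p_k$: $X\le^p_0X$; $M'\to_\circ L'\le^+_{k_1+k_2+1}M\to_\bullet L$ if $M'\le^-_{k_1}M$, $L'\le^+_{k_2}L$; $M'\to_cL'\le^p_{k_1+k_2}M\to_cL$ if $M'\le^{\bar p}_{k_1}M$, $L'\le^p_{k_2}L$; multisets/environments pointwise; $(\Gamma',L')\le^p_{k_1+k_2}(\Gamma,L)$ if $\Gamma'\le^{\bar p}_{k_1}\Gamma$, $L'\le^p_{k_2}L$. For $\lambda$-terms, $t\sqsubseteq^{\mathrm{pwc}}u$ iff for every $(\Gamma,L,k)\in[\![t^\bullet]\!]$ there exist $(\Gamma',L',k')\in[\![u^\bullet]\!]$ and $d$ with $(\Gamma',L')\le^+_d(\Gamma,L)$ and $k\ge k'+d$. -}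

module Defs where

open import Data.Nat using (ℕ; zero; suc; _+_; _≤_)
open import Data.Fin using (Fin; _↑ʳ_; _↑ˡ_; opposite)
import Data.Fin as Fin
open import Data.List using (List; []; _∷_)
open import Data.List.Relation.Binary.Permutation.Propositional using (_↭_)
open import Data.List.Relation.Binary.Pointwise using (Pointwise)
open import Data.Vec using (Vec; []; _∷_; lookup; replicate; zipWith; _++_; _[_]≔_)
import Data.Vec.Relation.Binary.Pointwise.Inductive as VP
open import Data.Product using (Σ; Σ-syntax; _×_; _,_)
open import Data.Sum using (_⊎_)
open import Data.Bool using (Bool; true; false; if_then_else_)
open import Relation.Nullary using (¬_)
open import Relation.Binary.PropositionalEquality using (_≡_)
open import Relation.Binary.Construct.Closure.ReflexiveTransitive using (Star)

data Term (n : ℕ) : Set where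
  var : Fin n → Term n
  lam : Term (suc n) → Term n
  app : Term n → Term n → Term n

ext : ∀ {m n} → (Fin m → Fin n) → Fin (suc m) → Fin (suc n)
ext ρ Fin.zero    = Fin.zero
ext ρ (Fin.suc i) = Fin.suc (ρ i)

ren : ∀ {m n} → (Fin m → Fin n) → Term m → Term n
ren ρ (var i)   = var (ρ i)
ren ρ (lam t)   = lam (ren (ext ρ) t)
ren ρ (app t u) = app (ren ρ t) (ren ρ u)

exts : ∀ {m n} → (Fin m → Term n) → Fin (suc m) → Term (suc n)
exts σ Fin.zero    = var Fin.zero
exts σ (Fin.suc i) = ren Fin.suc (σ i)

sub : ∀ {m n} → (Fin m → Term n) → Term m → Term n
sub σ (var i)   = σ i
sub σ (lam t)   = lam (sub (exts σ) t)
sub σ (app t u) = app (sub σ t) (sub σ u)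

sub0 : ∀ {n} → Term n → Fin (suc n) → Term n
sub0 u Fin.zero    = u
sub0 u (Fin.suc i) = var i

_[_]₀ : ∀ {n} → Term (suc n) → Term n → Term n
t [ u ]₀ = sub (sub0 u) t

data _⟶β_ {n : ℕ} : Term n → Term n → Set where
  β    : ∀ {t : Term (suc n)} {u} → app (lam t) u ⟶β (t [ u ]₀)
  ξlam : ∀ {t t' : Term (suc n)} → t ⟶β t' → lam t ⟶β lam t'
  ξl   : ∀ {t t' u} → t ⟶β t' → app t u ⟶β app t' u
  ξr   : ∀ {t u u'} → u ⟶β u' → app t u ⟶β app t u'

_⟶β*_ : ∀ {n} → Term n → Term n → Set
_⟶β*_ = Star _⟶β_

-- λ x₁ … x_j . t   (x_j innermost, i.e. de Bruijn index 0 in t)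
lams : ∀ {m} (j : ℕ) → Term (j + m) → Term m
lams zero    t = t
lams (suc j) t = lams j (lam t)

apps : ∀ {n k} → Term n → Vec (Term n) k → Term n
apps h []       = h
apps h (t ∷ ts) = apps (app h t) ts

wk : ∀ {n} (p : ℕ) → Term n → Term (p + n)
wk p = ren (p ↑ʳ_)

HasHNF : ∀ {m} → Term m → Set
HasHNF {m} t = Σ[ j ∈ ℕ ] Σ[ k ∈ ℕ ] Σ[ y ∈ Fin (j + m) ] Σ[ as ∈ Vec (Term (j + m)) k ]
  (t ⟶β* lams j (apps (var y) as))

TRel : Set₁
TRel = ∀ {m} → Term m → Term m → Set

-- the functional whose largest post-fixed point is ⊑_{Bηred}
-- t has hnf λx₁…x_{n+p}. y t₁⋯t_{k+p}, u has hnf λx₁…x_n. y u₁⋯u_k,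
-- the extra arguments t_{k+i} are related to the extra variables x_{n+i}
BηF : TRel → TRel
BηF R {m} t u =
  ¬ HasHNF t ⊎
  Σ[ n ∈ ℕ ] Σ[ p ∈ ℕ ] Σ[ k ∈ ℕ ] Σ[ y ∈ Fin (n + m) ]
  Σ[ us ∈ Vec (Term (n + m)) k ]
  Σ[ ts ∈ Vec (Term (p + (n + m))) k ]
  Σ[ es ∈ Vec (Term (p + (n + m))) p ]
    (t ⟶β* lams n (lams p (apps (var (p ↑ʳ y)) (ts ++ es))))
  × (u ⟶β* lams n (apps (var y) us))
  × (∀ (i : Fin k) → R (lookup ts i) (wk p (lookup us i)))
  × (∀ (i : Fin p) → R (lookup es i) (var (opposite i ↑ˡ (n + m))))

-- largest relation: union of all post-fixed points
_⊑Bηred_ : ∀ {m} → Term m → Term m → Set₁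
t ⊑Bηred u = Σ[ R ∈ TRel ] (∀ {m} {t' u' : Term m} → R t' u' → BηF R t' u') × R t u

data Col : Set where
  white black : Col

data CTerm (n : ℕ) : Set where
  var : Fin n → CTerm n
  lam : Col → CTerm (suc n) → CTerm n
  app : Col → CTerm n → CTerm n → CTerm n

_• : ∀ {n} → Term n → CTerm n
var x   • = var x
lam t   • = lam black (t •)
app t u • = app black (t •) (u •)

-- colored multi types; multisets represented by lists (up to permutation)
data Ty : Set where
  atom : ℕ → Ty
  _⇒⟨_⟩_ : List Ty → Col → Ty → Ty

MTy : Set
MTy = List Ty

data _≈T_ : Ty → Ty → Set
data _≈M_ : MTy → MTy → Set

data _≈T_ where
  atom : ∀ {a} → atom a ≈T atom a
  arr  : ∀ {M M' c L L'} → M ≈M M' → L ≈T L' → (M ⇒⟨ c ⟩ L) ≈T (M' ⇒⟨ c ⟩ L')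

data _≈M_ where
  perm : ∀ {M N M'} → M ↭ N → Pointwise _≈T_ N M' → M ≈M M'

Env : ℕ → Set
Env n = Vec MTy n

∅ : ∀ {n} → Env n
∅ = replicate _ []

_⊕_ : ∀ {n} → Env n → Env n → Env n
_⊕_ = zipWith Data.List._++_
  where import Data.List

_≈E_ : ∀ {n} → Env n → Env n → Set
_≈E_ = VP.Pointwise _≈M_

sameCol : Col → Col → Bool
sameCol white white = true
sameCol black black = true
sameCol _     _     = false

appCost : Col → Col → ℕ → ℕ → ℕ
appCost c d k₁ k₂ = if sameCol c d then k₁ + k₂ else k₁ + k₂ + 1

data _⊢_∶_[_] : ∀ {n} → Env n → CTerm n → Ty → ℕ → Set
data _⊢M_∶_[_] : ∀ {n} → Env n → CTerm n → MTy → ℕ → Set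

data _⊢_∶_[_] where
  ax   : ∀ {n} (x : Fin n) (L : Ty) → (∅ [ x ]≔ (L ∷ [])) ⊢ var x ∶ L [ 0 ]
  abs  : ∀ {n} {Γ : Env n} {M L k c t} →
         (M ∷ Γ) ⊢ t ∶ L [ k ] → Γ ⊢ lam c t ∶ (M ⇒⟨ c ⟩ L) [ k ]
  appr : ∀ {n} {Γ Δ : Env n} {M L k₁ k₂ c d t u} →
         Γ ⊢ t ∶ (M ⇒⟨ c ⟩ L) [ k₁ ] → Δ ⊢M u ∶ M [ k₂ ] →
         (Γ ⊕ Δ) ⊢ app d t u ∶ L [ appCost c d k₁ k₂ ]
  -- judgements are on multisets: closed under permutation of multisets
  conv : ∀ {n} {Γ Γ' : Env n} {t L L' k} →
         Γ ⊢ t ∶ L [ k ] → Γ ≈E Γ' → L ≈T L' → Γ' ⊢ t ∶ L' [ k ]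

data _⊢M_∶_[_] where
  mnil  : ∀ {n} {t : CTerm n} → ∅ ⊢M t ∶ [] [ 0 ]
  mcons : ∀ {n} {Γ Δ : Env n} {t L M k₁ k₂} →
          Γ ⊢ t ∶ L [ k₁ ] → Δ ⊢M t ∶ M [ k₂ ] → (Γ ⊕ Δ) ⊢M t ∶ (L ∷ M) [ k₁ + k₂ ]

-- Polarized whitening  L' ≤^p_k L   written  Wh p k L' L

data Pol : Set where
  pos negv : Pol

neg : Pol → Pol
neg pos = negv
neg negv = pos

data Wh : Pol → ℕ → Ty → Ty → Set
data WhL : Pol → ℕ → MTy → MTy → Set
data WhM : Pol → ℕ → MTy → MTy → Set

data Wh where
  atom  : ∀ {p a} → Wh p 0 (atom a) (atom a)
  whten : ∀ {k₁ k₂ M' M L' L} → WhM negv k₁ M' M → Wh pos k₂ L' L →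
          Wh pos (k₁ + k₂ + 1) (M' ⇒⟨ white ⟩ L') (M ⇒⟨ black ⟩ L)
  same  : ∀ {p c k₁ k₂ M' M L' L} → WhM (neg p) k₁ M' M → Wh p k₂ L' L →
          Wh p (k₁ + k₂) (M' ⇒⟨ c ⟩ L') (M ⇒⟨ c ⟩ L)

data WhL where
  []  : ∀ {p} → WhL p 0 [] []
  _∷_ : ∀ {p k₁ k₂ L' L M' M} → Wh p k₁ L' L → WhL p k₂ M' M →
        WhL p (k₁ + k₂) (L' ∷ M') (L ∷ M)

data WhM where
  perm : ∀ {p k M' N M} → M' ↭ N → WhL p k N M → WhM p k M' M

data WhE : ∀ {n} → Pol → ℕ → Env n → Env n → Set where
  []  : ∀ {p} → WhE p 0 [] []
  _∷_ : ∀ {n p k₁ k₂ M' M} {Γ' Γ : Env n} → WhM p k₁ M' M → WhE p k₂ Γ' Γ →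
        WhE p (k₁ + k₂) (M' ∷ Γ') (M ∷ Γ)

WhP : ∀ {n} → Pol → ℕ → Env n × Ty → Env n × Ty → Set
WhP p d (Γ' , L') (Γ , L) =
  Σ[ k₁ ∈ ℕ ] Σ[ k₂ ∈ ℕ ] (d ≡ k₁ + k₂) × WhE (neg p) k₁ Γ' Γ × Wh p k₂ L' L

_⊑pwc_ : ∀ {n} → Term n → Term n → Set
_⊑pwc_ {n} t u =
  ∀ (Γ : Env n) (L : Ty) (k : ℕ) → Γ ⊢ (t •) ∶ L [ k ] →
  Σ[ Γ' ∈ Env n ] Σ[ L' ∈ Ty ] Σ[ k' ∈ ℕ ] Σ[ d ∈ ℕ ]
    (Γ' ⊢ (u •) ∶ L' [ k' ]) × WhP pos d (Γ' , L') (Γ , L) × (k' + d ≤ k)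

-- Since t• is entirely black, a typing of t• only pays for the white arrows
-- that are applied, so it can be read as a typing of t with a cost; we index
-- it moreover by the size of the derivation.  Typings are stable under
-- β-reduction (with non-increasing size) and β-expansion, and a typable term
-- has a head normal form.  Given a typing of t, reduce t to its head normal
-- form λx₁…x_{n+p}. y t₁ ⋯ t_{k+p}; by induction on the size, every tᵢ with
-- i ≤ k is simulated by uᵢ and every extra argument t_{k+i} by the variable
-- x_{n+i}, which therefore receives the domain of the (n+i)-th abstraction of
-- t.  The remaining arrows of the type of u's head then match the extra
-- abstractions of t up to whitening: an extra argument passed through a white
-- arrow faces a black abstraction, which is exactly a positive whitening step,
-- paid for by the cost of that white application.  The simulating typings
-- assemble into a typing of the head normal form of u, hence of u.
module Submission where

open import Defs
open import Data.Nat using (ℕ; zero; suc; _+_; _≤_; _<_; z≤n; s≤s)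
open import Data.Nat.Properties
  using (+-assoc; +-identityʳ; +-suc; ≤-refl; ≤-trans; ≤-reflexive; <-≤-trans; n≤1+n; m≤n+m;
         m+n≤o⇒m≤o; m+n≤o⇒n≤o; +-mono-≤; +-monoˡ-<; +-monoʳ-<; +-commutativeSemigroup;
         module ≤-Reasoning)
open import Algebra.Properties.CommutativeSemigroup +-commutativeSemigroup
  using (x∙yz≈y∙xz) renaming (interchange to +-interchange)
open import Data.Nat.Tactic.RingSolver using (solve-∀)
open import Data.Fin using (Fin; _↑ˡ_; _↑ʳ_)
import Data.Fin as F
open import Data.List using (List; []; _∷_) renaming (_++_ to _++ₗ_)
import Data.List.Properties as List
open import Data.List.Relation.Binary.Permutation.Propositional
  using (_↭_; refl; prep; swap; trans; ↭-sym)
import Data.List.Relation.Binary.Permutation.Propositional.Properties as Perm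
open import Data.List.Relation.Binary.Pointwise using (Pointwise; []; _∷_)
import Data.List.Relation.Binary.Pointwise as Pointwise
open import Data.Vec using (Vec; []; _∷_; _++_; lookup; _[_]≔_; _∷ʳ_; splitAt)
open import Data.Vec.Relation.Binary.Pointwise.Inductive using ([]; _∷_)
open import Data.Product using (Σ-syntax; _×_; _,_)
open import Data.Sum using (inj₁; inj₂)
open import Data.Empty using (⊥-elim)
open import Data.Unit using (⊤; tt)
open import Relation.Binary.PropositionalEquality
  using (_≡_; refl; sym; cong; cong₂; subst; module ≡-Reasoning) renaming (trans to ≡-trans)
open import Relation.Binary.Construct.Closure.ReflexiveTransitive using (ε; _◅_)

-- Multisets of types up to permutation

Pointwise-↭ : ∀ {A B : Set} {R : A → B → Set} {xs : List A} {ys zs : List B} →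
              Pointwise R xs ys → ys ↭ zs → Σ[ xs' ∈ List A ] (xs ↭ xs') × Pointwise R xs' zs
Pointwise-↭ {xs = xs} rs refl = xs , refl , rs
Pointwise-↭ (r ∷ rs) (prep _ p) with Pointwise-↭ rs p
... | _ , q , rs' = _ , prep _ q , r ∷ rs'
Pointwise-↭ (r₁ ∷ r₂ ∷ rs) (swap _ _ p) with Pointwise-↭ rs p
... | _ , q , rs' = _ , swap _ _ q , r₂ ∷ r₁ ∷ rs'
Pointwise-↭ rs (trans p₁ p₂) with Pointwise-↭ rs p₁
... | _ , q₁ , rs₁ with Pointwise-↭ rs₁ p₂
... | xs₂ , q₂ , rs₂ = xs₂ , trans q₁ q₂ , rs₂

≈T-refl : ∀ A → A ≈T A
≈M-refl : ∀ M → M ≈M M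
Pointwise-≈T-refl : ∀ M → Pointwise _≈T_ M M
≈T-refl (atom a) = atom
≈T-refl (M ⇒⟨ c ⟩ L) = arr (≈M-refl M) (≈T-refl L)
≈M-refl M = perm refl (Pointwise-≈T-refl M)
Pointwise-≈T-refl [] = []
Pointwise-≈T-refl (A ∷ M) = ≈T-refl A ∷ Pointwise-≈T-refl M

≈T-sym : ∀ {A B} → A ≈T B → B ≈T A
≈M-sym : ∀ {M N} → M ≈M N → N ≈M M
Pointwise-≈T-sym : ∀ {M N} → Pointwise _≈T_ M N → Pointwise _≈T_ N M
≈T-sym atom = atom
≈T-sym (arr m l) = arr (≈M-sym m) (≈T-sym l)
≈M-sym (perm p rs) with Pointwise-↭ (Pointwise-≈T-sym rs) (↭-sym p)
... | _ , q , rs' = perm q rs'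
Pointwise-≈T-sym [] = []
Pointwise-≈T-sym (r ∷ rs) = ≈T-sym r ∷ Pointwise-≈T-sym rs

≈T-trans : ∀ {A B C} → A ≈T B → B ≈T C → A ≈T C
≈M-trans : ∀ {M N O} → M ≈M N → N ≈M O → M ≈M O
Pointwise-≈T-trans : ∀ {M N O} → Pointwise _≈T_ M N → Pointwise _≈T_ N O → Pointwise _≈T_ M O
≈T-trans atom atom = atom
≈T-trans (arr m l) (arr m' l') = arr (≈M-trans m m') (≈T-trans l l')
≈M-trans (perm p₁ rs₁) (perm p₂ rs₂) with Pointwise-↭ rs₁ p₂
... | _ , q , rs = perm (trans p₁ q) (Pointwise-≈T-trans rs rs₂)
Pointwise-≈T-trans [] [] = []
Pointwise-≈T-trans (r ∷ rs) (r' ∷ rs') = ≈T-trans r r' ∷ Pointwise-≈T-trans rs rs'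

≈T-reflexive : ∀ {A B} → A ≡ B → A ≈T B
≈T-reflexive {A} refl = ≈T-refl A

≈M-++ : ∀ {M M' N N'} → M ≈M M' → N ≈M N' → (M ++ₗ N) ≈M (M' ++ₗ N')
≈M-++ (perm p rs) (perm q rs') = perm (Perm.++⁺ p q) (Pointwise.++⁺ rs rs')

≈M-↭ : ∀ {M N} → M ↭ N → M ≈M N
≈M-↭ {N = N} p = perm p (Pointwise-≈T-refl N)

≈E-refl : ∀ {n} (Γ : Env n) → Γ ≈E Γ
≈E-refl [] = []
≈E-refl (M ∷ Γ) = ≈M-refl M ∷ ≈E-refl Γ

≈E-sym : ∀ {n} {Γ Δ : Env n} → Γ ≈E Δ → Δ ≈E Γ
≈E-sym [] = []
≈E-sym (e ∷ es) = ≈M-sym e ∷ ≈E-sym es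

≈E-trans : ∀ {n} {Γ Δ Θ : Env n} → Γ ≈E Δ → Δ ≈E Θ → Γ ≈E Θ
≈E-trans [] [] = []
≈E-trans (e ∷ es) (e' ∷ es') = ≈M-trans e e' ∷ ≈E-trans es es'

≈E-reflexive : ∀ {n} {Γ Δ : Env n} → Γ ≡ Δ → Γ ≈E Δ
≈E-reflexive {Γ = Γ} refl = ≈E-refl Γ

≈E-++ : ∀ {j n} (A C : Vec MTy j) {B D : Env n} → (A ++ B) ≈E (C ++ D) → (A ≈E C) × (B ≈E D)
≈E-++ [] [] e = [] , e
≈E-++ (a ∷ A) (c ∷ C) (e ∷ es) with ≈E-++ A C es
... | e₁ , e₂ = e ∷ e₁ , e₂

⊕-cong : ∀ {n} {Γ Γ' Δ Δ' : Env n} → Γ ≈E Γ' → Δ ≈E Δ' → (Γ ⊕ Δ) ≈E (Γ' ⊕ Δ')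
⊕-cong [] [] = []
⊕-cong (e ∷ es) (f ∷ fs) = ≈M-++ e f ∷ ⊕-cong es fs

⊕-identityˡ : ∀ {n} (Γ : Env n) → (∅ ⊕ Γ) ≡ Γ
⊕-identityˡ [] = refl
⊕-identityˡ (M ∷ Γ) = cong (M ∷_) (⊕-identityˡ Γ)

⊕-identityʳ : ∀ {n} (Γ : Env n) → (Γ ⊕ ∅) ≡ Γ
⊕-identityʳ [] = refl
⊕-identityʳ (M ∷ Γ) = cong₂ _∷_ (List.++-identityʳ M) (⊕-identityʳ Γ)

⊕-assoc : ∀ {n} (Γ Δ Θ : Env n) → ((Γ ⊕ Δ) ⊕ Θ) ≡ (Γ ⊕ (Δ ⊕ Θ))
⊕-assoc [] [] [] = refl
⊕-assoc (A ∷ Γ) (B ∷ Δ) (C ∷ Θ) = cong₂ _∷_ (List.++-assoc A B C) (⊕-assoc Γ Δ Θ)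

⊕-comm : ∀ {n} (Γ Δ : Env n) → (Γ ⊕ Δ) ≈E (Δ ⊕ Γ)
⊕-comm [] [] = []
⊕-comm (A ∷ Γ) (B ∷ Δ) = ≈M-↭ (Perm.++-comm A B) ∷ ⊕-comm Γ Δ

∅⊕∅ : ∀ {n} → (∅ {n} ⊕ ∅) ≡ ∅
∅⊕∅ = ⊕-identityˡ ∅

⊕-interchange : ∀ {n} (a b c d : Env n) → ((a ⊕ b) ⊕ (c ⊕ d)) ≈E ((a ⊕ c) ⊕ (b ⊕ d))
⊕-interchange a b c d =
  ≈E-trans (≈E-reflexive (⊕-assoc a b (c ⊕ d)))
  (≈E-trans (⊕-cong (≈E-refl a)
              (≈E-trans (≈E-reflexive (sym (⊕-assoc b c d)))
              (≈E-trans (⊕-cong (⊕-comm b c) (≈E-refl d)) (≈E-reflexive (⊕-assoc c b d)))))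
  (≈E-reflexive (sym (⊕-assoc a c (b ⊕ d)))))

∅++∅ : ∀ p {n} → (∅ {p} ++ ∅ {n}) ≡ ∅
∅++∅ zero = refl
∅++∅ (suc p) = cong ([] ∷_) (∅++∅ p)

++-⊕ : ∀ {j n} (A C : Vec MTy j) (B D : Env n) → ((A ++ B) ⊕ (C ++ D)) ≡ ((A ⊕ C) ++ (B ⊕ D))
++-⊕ [] [] B D = refl
++-⊕ (a ∷ A) (c ∷ C) B D = cong ((a ++ₗ c) ∷_) (++-⊕ A C B D)

⊕-∷ʳ : ∀ {p} (X Y : Vec MTy p) a b → ((X ∷ʳ a) ⊕ (Y ∷ʳ b)) ≡ ((X ⊕ Y) ∷ʳ (a ++ₗ b))
⊕-∷ʳ [] [] a b = refl
⊕-∷ʳ (x ∷ X) (y ∷ Y) a b = cong ((x ++ₗ y) ∷_) (⊕-∷ʳ X Y a b)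

∅∷ʳ[] : ∀ p → (∅ {p} ∷ʳ []) ≡ ∅
∅∷ʳ[] zero = refl
∅∷ʳ[] (suc p) = cong ([] ∷_) (∅∷ʳ[] p)

single : ∀ {n} → Fin n → MTy → Env n
single x M = ∅ [ x ]≔ M

single-⊕ : ∀ {n} (x : Fin n) A B → (single x A ⊕ single x B) ≡ single x (A ++ₗ B)
single-⊕ F.zero A B = cong ((A ++ₗ B) ∷_) ∅⊕∅
single-⊕ (F.suc x) A B = cong ([] ∷_) (single-⊕ x A B)

single-[] : ∀ {n} (x : Fin n) → single x [] ≡ ∅
single-[] F.zero = refl
single-[] (F.suc x) = cong ([] ∷_) (single-[] x)

single-cong : ∀ {n} (x : Fin n) {A B} → A ≈M B → single x A ≈E single x B
single-cong F.zero e = e ∷ ≈E-refl ∅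
single-cong (F.suc x) e = ≈M-refl [] ∷ single-cong x e

single-↑ʳ : ∀ p {n} (y : Fin n) X → single (p ↑ʳ y) X ≡ (∅ {p} ++ single y X)
single-↑ʳ zero y X = refl
single-↑ʳ (suc p) y X = cong ([] ∷_) (single-↑ʳ p y X)

single-↑ˡ : ∀ {p} (i : Fin p) n X → single (i ↑ˡ n) X ≡ (single i X ++ ∅ {n})
single-↑ˡ {suc p} F.zero n X = cong (X ∷_) (sym (∅++∅ p))
single-↑ˡ (F.suc i) n X = cong ([] ∷_) (single-↑ˡ i n X)

single-fromℕ : ∀ p B → single (F.fromℕ p) B ≡ (∅ {p} ∷ʳ B)
single-fromℕ zero B = refl
single-fromℕ (suc p) B = cong ([] ∷_) (single-fromℕ p B)

single-inject₁ : ∀ {p} (i : Fin p) B → single (F.inject₁ i) B ≡ (single i B ∷ʳ [])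
single-inject₁ {suc p} F.zero B = cong (B ∷_) (sym (∅∷ʳ[] p))
single-inject₁ (F.suc i) B = cong ([] ∷_) (single-inject₁ i B)

renEnv : ∀ {m n} → (Fin m → Fin n) → Env m → Env n
renEnv ρ [] = ∅
renEnv ρ (M ∷ Γ) = single (ρ F.zero) M ⊕ renEnv (λ i → ρ (F.suc i)) Γ

renEnv-suc : ∀ {m n} (ρ : Fin m → Fin n) (Γ : Env m) → renEnv (λ i → F.suc (ρ i)) Γ ≡ [] ∷ renEnv ρ Γ
renEnv-suc ρ [] = refl
renEnv-suc ρ (M ∷ Γ) = cong (single (F.suc (ρ F.zero)) M ⊕_) (renEnv-suc (λ i → ρ (F.suc i)) Γ)

renEnv-id : ∀ {m} (Γ : Env m) → renEnv (λ i → i) Γ ≡ Γ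
renEnv-id [] = refl
renEnv-id (M ∷ Γ) rewrite renEnv-suc (λ i → i) Γ =
  cong₂ _∷_ (List.++-identityʳ M) (≡-trans (⊕-identityˡ _) (renEnv-id Γ))

renEnv-↑ʳ : ∀ p {n} (G : Env n) → renEnv (p ↑ʳ_) G ≡ (∅ {p} ++ G)
renEnv-↑ʳ zero G = renEnv-id G
renEnv-↑ʳ (suc p) G = ≡-trans (renEnv-suc (p ↑ʳ_) G) (cong ([] ∷_) (renEnv-↑ʳ p G))

renEnv-↑ˡ : ∀ {q p} n (f : Fin q → Fin p) (Bs : Vec MTy q) → renEnv (λ j → f j ↑ˡ n) Bs ≡ (renEnv f Bs ++ ∅ {n})
renEnv-↑ˡ {p = p} n f [] = sym (∅++∅ p)
renEnv-↑ˡ n f (B ∷ Bs) =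
  ≡-trans (cong₂ _⊕_ (single-↑ˡ (f F.zero) n B) (renEnv-↑ˡ n (λ j → f (F.suc j)) Bs))
  (≡-trans (++-⊕ (single (f F.zero) B) (renEnv (λ j → f (F.suc j)) Bs) ∅ ∅)
           (cong ((single (f F.zero) B ⊕ renEnv (λ j → f (F.suc j)) Bs) ++_) ∅⊕∅))

renEnv-inject₁ : ∀ {q p} (g : Fin q → Fin p) (Bs : Vec MTy q) → renEnv (λ j → F.inject₁ (g j)) Bs ≡ (renEnv g Bs ∷ʳ [])
renEnv-inject₁ {p = p} g [] = sym (∅∷ʳ[] p)
renEnv-inject₁ g (B ∷ Bs) =
  ≡-trans (cong₂ _⊕_ (single-inject₁ (g F.zero) B) (renEnv-inject₁ (λ j → g (F.suc j)) Bs))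
          (⊕-∷ʳ (single (g F.zero) B) (renEnv (λ j → g (F.suc j)) Bs) [] [])

renEnv-opposite : ∀ {q} (B : MTy) (Bs : Vec MTy q) → renEnv F.opposite (B ∷ Bs) ≡ (renEnv F.opposite Bs ∷ʳ B)
renEnv-opposite {q} B Bs =
  ≡-trans (cong₂ _⊕_ (single-fromℕ q B) (renEnv-inject₁ F.opposite Bs))
  (≡-trans (⊕-∷ʳ ∅ (renEnv F.opposite Bs) B [])
           (cong₂ _∷ʳ_ (⊕-identityˡ _) (List.++-identityʳ B)))

-- Black typing with cost and size

whiteCost : Col → ℕ
whiteCost white = 1
whiteCost black = 0

-- For a plain term t, Γ ⊩ t ∶ L [ k , s ] is a derivation of Γ ⊢ t• ∶ L [ k ]
-- with a size s: an application of t• costs one exactly when its arrow is white.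
infix 4 _⊩_∶_[_,_] _⊩M_∶_[_,_]
data _⊩_∶_[_,_] : ∀ {n} → Env n → Term n → Ty → ℕ → ℕ → Set
data _⊩M_∶_[_,_] : ∀ {n} → Env n → Term n → MTy → ℕ → ℕ → Set

data _⊩_∶_[_,_] where
  ax   : ∀ {n} (x : Fin n) (L : Ty) → single x (L ∷ []) ⊩ var x ∶ L [ 0 , 0 ]
  abs  : ∀ {n} {Γ : Env n} {M L k s t} →
         (M ∷ Γ) ⊩ t ∶ L [ k , s ] → Γ ⊩ lam t ∶ (M ⇒⟨ black ⟩ L) [ k , suc s ]
  appr : ∀ {n} {Γ Δ : Env n} {M L k₁ k₂ s₁ s₂ c t u} →
         Γ ⊩ t ∶ (M ⇒⟨ c ⟩ L) [ k₁ , s₁ ] → Δ ⊩M u ∶ M [ k₂ , s₂ ] →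
         (Γ ⊕ Δ) ⊩ app t u ∶ L [ k₁ + k₂ + whiteCost c , suc (s₁ + s₂) ]
  conv : ∀ {n} {Γ Γ' : Env n} {t L L' k s} →
         Γ ⊩ t ∶ L [ k , s ] → Γ ≈E Γ' → L ≈T L' → Γ' ⊩ t ∶ L' [ k , s ]

data _⊩M_∶_[_,_] where
  mnil  : ∀ {n} {t : Term n} → ∅ ⊩M t ∶ [] [ 0 , 0 ]
  mcons : ∀ {n} {Γ Δ : Env n} {t L M k₁ k₂ s₁ s₂} →
          Γ ⊩ t ∶ L [ k₁ , s₁ ] → Δ ⊩M t ∶ M [ k₂ , s₂ ] → (Γ ⊕ Δ) ⊩M t ∶ (L ∷ M) [ k₁ + k₂ , s₁ + s₂ ]

⊩-cast : ∀ {n} {Γ : Env n} {t L k k' s s'} → k ≡ k' → s ≡ s' → Γ ⊩ t ∶ L [ k , s ] → Γ ⊩ t ∶ L [ k' , s' ]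
⊩-cast refl refl D = D

⊩M-cast : ∀ {n} {Γ : Env n} {t M k k' s s'} → k ≡ k' → s ≡ s' → Γ ⊩M t ∶ M [ k , s ] → Γ ⊩M t ∶ M [ k' , s' ]
⊩M-cast refl refl D = D

⊩-castE : ∀ {n} {Γ Γ' : Env n} {t L k s} → Γ ≡ Γ' → Γ ⊩ t ∶ L [ k , s ] → Γ' ⊩ t ∶ L [ k , s ]
⊩-castE refl D = D

⊩M-castE : ∀ {n} {Γ Γ' : Env n} {t M k s} → Γ ≡ Γ' → Γ ⊩M t ∶ M [ k , s ] → Γ' ⊩M t ∶ M [ k , s ]
⊩M-castE refl D = D

⊢-cast : ∀ {n} {Γ : Env n} {ct L k k'} → k ≡ k' → Γ ⊢ ct ∶ L [ k ] → Γ ⊢ ct ∶ L [ k' ]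
⊢-cast refl D = D

⊢•⇒⊩ : ∀ {n} {Γ : Env n} {ct L k} → Γ ⊢ ct ∶ L [ k ] → ∀ (t : Term n) → ct ≡ (t •) → Σ[ s ∈ ℕ ] (Γ ⊩ t ∶ L [ k , s ])
⊢M•⇒⊩M : ∀ {n} {Γ : Env n} {ct M k} → Γ ⊢M ct ∶ M [ k ] → ∀ (t : Term n) → ct ≡ (t •) → Σ[ s ∈ ℕ ] (Γ ⊩M t ∶ M [ k , s ])
⊢•⇒⊩ (ax x L) (var y) refl = 0 , ax x L
⊢•⇒⊩ (abs D) (lam b) refl with ⊢•⇒⊩ D b refl
... | s , d = suc s , abs d
⊢•⇒⊩ (appr {k₁ = k₁} {k₂ = k₂} {c = black} D Ds) (app a b) refl with ⊢•⇒⊩ D a refl | ⊢M•⇒⊩M Ds b refl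
... | _ , d₁ | _ , d₂ = _ , ⊩-cast (+-identityʳ (k₁ + k₂)) refl (appr d₁ d₂)
⊢•⇒⊩ (appr {c = white} D Ds) (app a b) refl with ⊢•⇒⊩ D a refl | ⊢M•⇒⊩M Ds b refl
... | _ , d₁ | _ , d₂ = _ , appr d₁ d₂
⊢•⇒⊩ (conv D e l) t refl with ⊢•⇒⊩ D t refl
... | s , d = s , conv d e l
⊢M•⇒⊩M mnil t refl = 0 , mnil
⊢M•⇒⊩M (mcons D Ds) t refl with ⊢•⇒⊩ D t refl | ⊢M•⇒⊩M Ds t refl
... | _ , d₁ | _ , d₂ = _ , mcons d₁ d₂

⊩⇒⊢• : ∀ {n} {Γ : Env n} {t L k s} → Γ ⊩ t ∶ L [ k , s ] → Γ ⊢ (t •) ∶ L [ k ]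
⊩M⇒⊢M• : ∀ {n} {Γ : Env n} {t M k s} → Γ ⊩M t ∶ M [ k , s ] → Γ ⊢M (t •) ∶ M [ k ]
⊩⇒⊢• (ax x L) = ax x L
⊩⇒⊢• (abs D) = abs (⊩⇒⊢• D)
⊩⇒⊢• (appr {k₁ = k₁} {k₂ = k₂} {c = black} D Ds) =
  ⊢-cast (sym (+-identityʳ (k₁ + k₂))) (appr (⊩⇒⊢• D) (⊩M⇒⊢M• Ds))
⊩⇒⊢• (appr {c = white} D Ds) = appr (⊩⇒⊢• D) (⊩M⇒⊢M• Ds)
⊩⇒⊢• (conv D e l) = conv (⊩⇒⊢• D) e l
⊩M⇒⊢M• mnil = mnil
⊩M⇒⊢M• (mcons D Ds) = mcons (⊩⇒⊢• D) (⊩M⇒⊢M• Ds)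

convE : ∀ {n} {Γ Γ' : Env n} {t L k s} → Γ ⊩ t ∶ L [ k , s ] → Γ ≈E Γ' → Γ' ⊩ t ∶ L [ k , s ]
convE {L = L} D e = conv D e (≈T-refl L)

convT : ∀ {n} {Γ : Env n} {t L L' k s} → Γ ⊩ t ∶ L [ k , s ] → L ≈T L' → Γ ⊩ t ∶ L' [ k , s ]
convT {Γ = Γ} D e = conv D (≈E-refl Γ) e

⊩M-var : ∀ {n} (x : Fin n) (M : MTy) → single x M ⊩M var x ∶ M [ 0 , 0 ]
⊩M-var x [] = ⊩M-castE (sym (single-[] x)) mnil
⊩M-var x (L ∷ M) = ⊩M-castE (single-⊕ x (L ∷ []) M) (mcons (ax x L) (⊩M-var x M))

⊩-var-inv : ∀ {n} {Δ : Env n} {x L k s} → Δ ⊩ var x ∶ L [ k , s ] →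
            (k ≡ 0) × (s ≡ 0) × (Δ ≈E single x (L ∷ []))
⊩-var-inv (ax x L) = refl , refl , ≈E-refl _
⊩-var-inv (conv D e l) with ⊩-var-inv D
... | refl , refl , e' = refl , refl , ≈E-trans (≈E-sym e) (≈E-trans e' (single-cong _ (perm refl (l ∷ []))))

⊩M-var-inv : ∀ {n} {Δ : Env n} {x M k s} → Δ ⊩M var x ∶ M [ k , s ] → (k ≡ 0) × (s ≡ 0) × (Δ ≈E single x M)
⊩M-var-inv {x = x} mnil = refl , refl , ≈E-reflexive (sym (single-[] x))
⊩M-var-inv {x = x} (mcons {L = L} {M = M} D Ds) with ⊩-var-inv D | ⊩M-var-inv Ds
... | refl , refl , e | refl , refl , e' = refl , refl , ≈E-trans (⊕-cong e e') (≈E-reflexive (single-⊕ x (L ∷ []) M))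

⊩M-++ : ∀ {n} {Δ₁ Δ₂ : Env n} {t M₁ M₂ k₁ k₂ s₁ s₂} →
        Δ₁ ⊩M t ∶ M₁ [ k₁ , s₁ ] → Δ₂ ⊩M t ∶ M₂ [ k₂ , s₂ ] →
        (Δ₁ ⊕ Δ₂) ⊩M t ∶ (M₁ ++ₗ M₂) [ k₁ + k₂ , s₁ + s₂ ]
⊩M-++ {Δ₂ = Δ₂} mnil D₂ = ⊩M-castE (sym (⊕-identityˡ Δ₂)) D₂
⊩M-++ {Δ₂ = Δ₂} (mcons {Γ = Γ} {Δ = Δ} {k₁ = a} {k₂ = b} {s₁ = c} {s₂ = d} D Ds) D₂ =
  ⊩M-castE (sym (⊕-assoc Γ Δ Δ₂)) (⊩M-cast (sym (+-assoc a b _)) (sym (+-assoc c d _)) (mcons D (⊩M-++ Ds D₂)))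

record ⊩M-Split {n} (Δ : Env n) (t : Term n) (M₁ M₂ : MTy) (k s : ℕ) : Set where
  constructor split
  field
    {Δ₁ Δ₂} : Env n
    {k₁ k₂ s₁ s₂} : ℕ
    d₁ : Δ₁ ⊩M t ∶ M₁ [ k₁ , s₁ ]
    d₂ : Δ₂ ⊩M t ∶ M₂ [ k₂ , s₂ ]
    eΔ : Δ ≡ (Δ₁ ⊕ Δ₂)
    ek : k ≡ k₁ + k₂
    es : s ≡ s₁ + s₂

⊩M-split : ∀ {n} {Δ : Env n} {t} M₁ {M₂ k s} → Δ ⊩M t ∶ (M₁ ++ₗ M₂) [ k , s ] → ⊩M-Split Δ t M₁ M₂ k s
⊩M-split [] D = split mnil D (sym (⊕-identityˡ _)) refl refl
⊩M-split (L ∷ M₁) (mcons {Γ = Γ} {k₁ = a} {s₁ = c} D Ds) with ⊩M-split M₁ Ds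
... | split {Δ₁} {Δ₂} {k₁} {k₂} {s₁} {s₂} d₁ d₂ refl refl refl =
  split (mcons D d₁) d₂ (sym (⊕-assoc Γ Δ₁ Δ₂)) (sym (+-assoc a k₁ k₂)) (sym (+-assoc c s₁ s₂))

record ⊩M-UpTo {n} (Δ : Env n) (t : Term n) (N : MTy) (k s : ℕ) : Set where
  constructor upTo
  field
    {Δ'} : Env n
    d : Δ' ⊩M t ∶ N [ k , s ]
    e : Δ' ≈E Δ

⊩M-↭ : ∀ {n} {Δ : Env n} {t M N k s} → Δ ⊩M t ∶ M [ k , s ] → M ↭ N → ⊩M-UpTo Δ t N k s
⊩M-↭ D refl = upTo D (≈E-refl _)
⊩M-↭ (mcons {Γ = Γ} D Ds) (prep _ p) with ⊩M-↭ Ds p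
... | upTo d e = upTo (mcons D d) (⊕-cong (≈E-refl Γ) e)
⊩M-↭ (mcons {Γ = Γ₁} {k₁ = a} {s₁ = c} D₁ (mcons {Γ = Γ₂} {Δ = Δ} {k₁ = b} {k₂ = k} {s₁ = d} {s₂ = s} D₂ Ds))
      (swap _ _ p) with ⊩M-↭ Ds p
... | upTo {Δ'} d' e =
  upTo (⊩M-cast (x∙yz≈y∙xz b a k) (x∙yz≈y∙xz d c s) (mcons D₂ (mcons D₁ d')))
    (≈E-trans (≈E-reflexive (sym (⊕-assoc Γ₂ Γ₁ Δ')))
    (≈E-trans (⊕-cong (⊕-comm Γ₂ Γ₁) e) (≈E-reflexive (⊕-assoc Γ₁ Γ₂ Δ))))
⊩M-↭ D (trans p q) with ⊩M-↭ D p
... | upTo d e with ⊩M-↭ d q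
... | upTo d' e' = upTo d' (≈E-trans e' e)

⊩M-pointwise : ∀ {n} {Δ : Env n} {t M N k s} → Δ ⊩M t ∶ M [ k , s ] → Pointwise _≈T_ M N → Δ ⊩M t ∶ N [ k , s ]
⊩M-pointwise mnil [] = mnil
⊩M-pointwise (mcons D Ds) (r ∷ rs) = mcons (convT D r) (⊩M-pointwise Ds rs)

⊩M-≈ : ∀ {n} {Δ : Env n} {t M N k s} → Δ ⊩M t ∶ M [ k , s ] → M ≈M N → ⊩M-UpTo Δ t N k s
⊩M-≈ D (perm p rs) with ⊩M-↭ D p
... | upTo d e = upTo (⊩M-pointwise d rs) e

record LamInv {n} (Δ : Env n) (b : Term (suc n)) (L : Ty) (k s : ℕ) : Set where
  constructor lamInv
  field
    {M} : MTy
    {L₀} : Ty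
    {s₀} : ℕ
    eL : L ≈T (M ⇒⟨ black ⟩ L₀)
    d : (M ∷ Δ) ⊩ b ∶ L₀ [ k , s₀ ]
    es : s ≡ suc s₀

⊩-lam-inv : ∀ {n} {Δ : Env n} {b L k s} → Δ ⊩ lam b ∶ L [ k , s ] → LamInv Δ b L k s
⊩-lam-inv (abs D) = lamInv (≈T-refl _) D refl
⊩-lam-inv (conv D e l) with ⊩-lam-inv D
... | lamInv eL d es = lamInv (≈T-trans (≈T-sym l) eL) (convE d (≈M-refl _ ∷ e)) es

record AppInv {n} (Δ : Env n) (a b : Term n) (L : Ty) (k s : ℕ) : Set where
  constructor appInv
  field
    {Δ₁ Δ₂} : Env n
    {M} : MTy
    {c} : Col
    {k₁ k₂ s₁ s₂} : ℕ
    da : Δ₁ ⊩ a ∶ (M ⇒⟨ c ⟩ L) [ k₁ , s₁ ]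
    db : Δ₂ ⊩M b ∶ M [ k₂ , s₂ ]
    eΔ : Δ ≈E (Δ₁ ⊕ Δ₂)
    ek : k ≡ k₁ + k₂ + whiteCost c
    es : s ≡ suc (s₁ + s₂)

⊩-app-inv : ∀ {n} {Δ : Env n} {a b L k s} → Δ ⊩ app a b ∶ L [ k , s ] → AppInv Δ a b L k s
⊩-app-inv (appr D Ds) = appInv D Ds (≈E-refl _) refl refl
⊩-app-inv (conv D e l) with ⊩-app-inv D
... | appInv da db eΔ ek es = appInv (convT da (arr (≈M-refl _) l)) db (≈E-trans (≈E-sym e) eΔ) ek es

-- Substitution

sub-cong : ∀ {m n} {σ τ : Fin m → Term n} → (∀ i → σ i ≡ τ i) → ∀ t → sub σ t ≡ sub τ t
sub-cong e (var i) = e i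
sub-cong {σ = σ} {τ} e (lam t) = cong lam (sub-cong exts-cong t)
  where
  exts-cong : ∀ i → exts σ i ≡ exts τ i
  exts-cong F.zero = refl
  exts-cong (F.suc i) = cong (ren F.suc) (e i)
sub-cong e (app t u) = cong₂ app (sub-cong e t) (sub-cong e u)

ren-sub : ∀ {m n} (ρ : Fin m → Fin n) t → ren ρ t ≡ sub (λ i → var (ρ i)) t
ren-sub ρ (var i) = refl
ren-sub ρ (lam t) = cong lam (≡-trans (ren-sub (ext ρ) t) (sub-cong ext-var t))
  where
  ext-var : ∀ i → var (ext ρ i) ≡ exts (λ i → var (ρ i)) i
  ext-var F.zero = refl
  ext-var (F.suc i) = refl
ren-sub ρ (app t u) = cong₂ app (ren-sub ρ t) (ren-sub ρ u)

⊩-castT : ∀ {n} {Γ : Env n} {t t' L k s} → t ≡ t' → Γ ⊩ t ∶ L [ k , s ] → Γ ⊩ t' ∶ L [ k , s ]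
⊩-castT refl D = D

⊩M-castT : ∀ {n} {Γ : Env n} {t t' M k s} → t ≡ t' → Γ ⊩M t ∶ M [ k , s ] → Γ ⊩M t' ∶ M [ k , s ]
⊩M-castT refl D = D

data _⊩ˢ_∶_[_,_] {n} : ∀ {m} → Env n → (Fin m → Term n) → Env m → ℕ → ℕ → Set where
  snil  : ∀ {σ : Fin 0 → Term n} → ∅ ⊩ˢ σ ∶ [] [ 0 , 0 ]
  scons : ∀ {m} {σ : Fin (suc m) → Term n} {M Γ Δ₁ Δ₂ k₁ k₂ s₁ s₂} →
          Δ₁ ⊩M σ F.zero ∶ M [ k₁ , s₁ ] → Δ₂ ⊩ˢ (λ i → σ (F.suc i)) ∶ Γ [ k₂ , s₂ ] →
          (Δ₁ ⊕ Δ₂) ⊩ˢ σ ∶ (M ∷ Γ) [ k₁ + k₂ , s₁ + s₂ ]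

⊩ˢ-castE : ∀ {m n} {σ : Fin m → Term n} {Γ Δ Δ' j r} → Δ ≡ Δ' → Δ ⊩ˢ σ ∶ Γ [ j , r ] → Δ' ⊩ˢ σ ∶ Γ [ j , r ]
⊩ˢ-castE refl S = S

⊩ˢ-cast : ∀ {m n} {σ : Fin m → Term n} {Γ Δ j j' r r'} → j ≡ j' → r ≡ r' → Δ ⊩ˢ σ ∶ Γ [ j , r ] → Δ ⊩ˢ σ ∶ Γ [ j' , r' ]
⊩ˢ-cast refl refl S = S

⊩ˢ-∅-inv : ∀ {m n} {σ : Fin m → Term n} {Δ j r} → Δ ⊩ˢ σ ∶ ∅ [ j , r ] → (Δ ≡ ∅) × (j ≡ 0) × (r ≡ 0)
⊩ˢ-∅-inv snil = refl , refl , refl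
⊩ˢ-∅-inv (scons mnil S) with ⊩ˢ-∅-inv S
... | refl , refl , refl = ∅⊕∅ , refl , refl

⊩ˢ-∅ : ∀ {m n} (σ : Fin m → Term n) → ∅ ⊩ˢ σ ∶ ∅ [ 0 , 0 ]
⊩ˢ-∅ {zero} σ = snil
⊩ˢ-∅ {suc m} σ = ⊩ˢ-castE ∅⊕∅ (scons mnil (⊩ˢ-∅ (λ i → σ (F.suc i))))

⊩ˢ-var : ∀ {m n} (ρ : Fin m → Fin n) (Γ : Env m) → renEnv ρ Γ ⊩ˢ (λ i → var (ρ i)) ∶ Γ [ 0 , 0 ]
⊩ˢ-var ρ [] = snil
⊩ˢ-var ρ (M ∷ Γ) = scons (⊩M-var (ρ F.zero) M) (⊩ˢ-var (λ i → ρ (F.suc i)) Γ)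

⊩ˢ-var-inv : ∀ {m n} (ρ : Fin m → Fin n) {Γ Δ j r} → Δ ⊩ˢ (λ i → var (ρ i)) ∶ Γ [ j , r ] →
             (Δ ≈E renEnv ρ Γ) × (j ≡ 0)
⊩ˢ-var-inv ρ snil = ≈E-refl _ , refl
⊩ˢ-var-inv ρ (scons D S) with ⊩M-var-inv D | ⊩ˢ-var-inv (λ i → ρ (F.suc i)) S
... | refl , refl , e | e' , refl = ⊕-cong e e' , refl

record ⊩ˢ-UpTo {m n} (Δ : Env n) (σ : Fin m → Term n) (Γ : Env m) (j r : ℕ) : Set where
  constructor upTo
  field
    {Δ'} : Env n
    S : Δ' ⊩ˢ σ ∶ Γ [ j , r ]
    e : Δ' ≈E Δ

⊩ˢ-conv : ∀ {m n} {σ : Fin m → Term n} {Γ Γ' Δ j r} → Γ ≈E Γ' → Δ ⊩ˢ σ ∶ Γ' [ j , r ] → ⊩ˢ-UpTo Δ σ Γ j r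
⊩ˢ-conv [] snil = upTo snil (≈E-refl _)
⊩ˢ-conv (e ∷ es) (scons D S) with ⊩M-≈ D (≈M-sym e) | ⊩ˢ-conv es S
... | upTo d e₁ | upTo S' e₂ = upTo (scons d S') (⊕-cong e₁ e₂)

record ⊩ˢ-Split {m n} (Δ : Env n) (σ : Fin m → Term n) (Γ₁ Γ₂ : Env m) (j r : ℕ) : Set where
  constructor split
  field
    {Δ₁ Δ₂} : Env n
    {j₁ j₂ r₁ r₂} : ℕ
    S₁ : Δ₁ ⊩ˢ σ ∶ Γ₁ [ j₁ , r₁ ]
    S₂ : Δ₂ ⊩ˢ σ ∶ Γ₂ [ j₂ , r₂ ]
    e : Δ ≈E (Δ₁ ⊕ Δ₂)
    ej : j ≡ j₁ + j₂
    er : r ≡ r₁ + r₂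

⊩ˢ-split : ∀ {m n} {σ : Fin m → Term n} (Γ₁ Γ₂ : Env m) {Δ j r} → Δ ⊩ˢ σ ∶ (Γ₁ ⊕ Γ₂) [ j , r ] →
           ⊩ˢ-Split Δ σ Γ₁ Γ₂ j r
⊩ˢ-split [] [] snil = split snil snil (≈E-reflexive (sym ∅⊕∅)) refl refl
⊩ˢ-split (M₁ ∷ Γ₁) (M₂ ∷ Γ₂) (scons D S) with ⊩M-split M₁ D | ⊩ˢ-split Γ₁ Γ₂ S
... | split {E₁} {E₂} {a} {b} {c} {d} d₁ d₂ refl refl refl | split {D₁} {D₂} {j₁} {j₂} {r₁} {r₂} S₁ S₂ e refl refl =
  split (scons d₁ S₁) (scons d₂ S₂) (≈E-trans (⊕-cong (≈E-refl _) e) (⊕-interchange E₁ E₂ D₁ D₂))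
    (+-interchange a b j₁ j₂) (+-interchange c d r₁ r₂)

⊩ˢ-merge : ∀ {m n} {σ : Fin m → Term n} {Γ₁ Γ₂ Δ₁ Δ₂ j₁ j₂ r₁ r₂} →
           Δ₁ ⊩ˢ σ ∶ Γ₁ [ j₁ , r₁ ] → Δ₂ ⊩ˢ σ ∶ Γ₂ [ j₂ , r₂ ] → ⊩ˢ-UpTo (Δ₁ ⊕ Δ₂) σ (Γ₁ ⊕ Γ₂) (j₁ + j₂) (r₁ + r₂)
⊩ˢ-merge snil snil = upTo snil (≈E-reflexive (sym ∅⊕∅))
⊩ˢ-merge (scons {Δ₁ = E₁} {Δ₂ = R₁} {k₁ = a} {k₂ = b} {s₁ = c} {s₂ = d} D₁ S₁)
         (scons {Δ₁ = E₂} {Δ₂ = R₂} {k₁ = a'} {k₂ = b'} {s₁ = c'} {s₂ = d'} D₂ S₂) with ⊩ˢ-merge S₁ S₂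
... | upTo S e = upTo (⊩ˢ-cast (+-interchange a a' b b') (+-interchange c c' d d') (scons (⊩M-++ D₁ D₂) S))
                      (≈E-trans (⊕-cong (≈E-refl _) e) (⊕-interchange E₁ E₂ R₁ R₂))

record ⊩-UpTo {n} (Δ : Env n) (t : Term n) (L : Ty) (k s : ℕ) : Set where
  constructor upTo
  field
    {Δ'} : Env n
    d : Δ' ⊩ t ∶ L [ k , s ]
    e : Δ' ≈E Δ

⊩ˢ-single-inv : ∀ {m n} {σ : Fin m → Term n} (x : Fin m) {L Δ j r} →
                Δ ⊩ˢ σ ∶ single x (L ∷ []) [ j , r ] → ⊩-UpTo Δ (σ x) L j r
⊩ˢ-single-inv F.zero (scons (mcons {Γ = Γ} {k₁ = k} {s₁ = s} D mnil) S) with ⊩ˢ-∅-inv S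
... | refl , refl , refl =
  upTo (⊩-cast (sym (≡-trans (+-identityʳ _) (+-identityʳ k))) (sym (≡-trans (+-identityʳ _) (+-identityʳ s))) D)
       (≈E-reflexive (sym (≡-trans (⊕-identityʳ _) (⊕-identityʳ Γ))))
⊩ˢ-single-inv (F.suc x) (scons mnil S) with ⊩ˢ-single-inv x S
... | upTo d e = upTo d (≈E-trans e (≈E-reflexive (sym (⊕-identityˡ _))))

⊩ˢ-single : ∀ {m n} {σ : Fin m → Term n} (i : Fin m) {Δ M k s} → Δ ⊩M σ i ∶ M [ k , s ] → ⊩ˢ-UpTo Δ σ (single i M) k s
⊩ˢ-single {σ = σ} F.zero {k = k} {s} D =
  upTo (⊩ˢ-cast (+-identityʳ k) (+-identityʳ s) (scons D (⊩ˢ-∅ (λ i → σ (F.suc i))))) (≈E-reflexive (⊕-identityʳ _))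
⊩ˢ-single (F.suc i) D with ⊩ˢ-single i D
... | upTo S e = upTo (scons mnil S) (≈E-trans (≈E-reflexive (⊕-identityˡ _)) e)

+-interchange-+ : ∀ a b c d w → (a + b + w) + (c + d) ≡ (a + c) + (b + d) + w
+-interchange-+ = solve-∀

suc-interchange : ∀ a b c d → suc (a + b) + (c + d) ≡ suc ((a + c) + (b + d))
suc-interchange = solve-∀

-- Weakening a typed substitution needs weakening of terms, itself a case of the
-- substitution lemma at renamings; hence the lemma is proved for any class of
-- substitutions whose typings can be weakened, and instantiated twice.
module SubstitutionLemma
  (Admissible : ∀ {m n} → (Fin m → Term n) → Set)
  (admissible-exts : ∀ {m n} {σ : Fin m → Term n} → Admissible σ → Admissible (exts σ))
  (admissible-wk : ∀ {m n} {σ : Fin m → Term n} {Γ Δ j r} → Admissible σ → Δ ⊩ˢ σ ∶ Γ [ j , r ] →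
                   ⊩ˢ-UpTo ([] ∷ Δ) (λ i → ren F.suc (σ i)) Γ j r) where

  ⊩-sub : ∀ {m n} {σ : Fin m → Term n} {Γ t L k s Δ j r} → Admissible σ →
          Γ ⊩ t ∶ L [ k , s ] → Δ ⊩ˢ σ ∶ Γ [ j , r ] → Δ ⊩ sub σ t ∶ L [ k + j , s + r ]
  ⊩M-sub : ∀ {m n} {σ : Fin m → Term n} {Γ t M k s Δ j r} → Admissible σ →
           Γ ⊩M t ∶ M [ k , s ] → Δ ⊩ˢ σ ∶ Γ [ j , r ] → ⊩M-UpTo Δ (sub σ t) M (k + j) (s + r)
  ⊩-sub g (ax x L) S with ⊩ˢ-single-inv x S
  ... | upTo d e = convE d e
  ⊩-sub {Δ = Δ} g (abs {M = M} D) S with admissible-wk g S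
  ... | upTo S' e' =
    abs (convE (⊩-sub (admissible-exts g) D (scons (⊩M-var F.zero M) S'))
               (≈E-trans (⊕-cong (≈E-refl _) e') (≈E-reflexive (cong₂ _∷_ (List.++-identityʳ M) (⊕-identityˡ Δ)))))
  ⊩-sub g (appr {Γ = Γ₁} {Δ = Γ₂} {k₁ = k₁} {k₂ = k₂} {s₁ = s₁} {s₂ = s₂} {c = c} D Ds) S
    with ⊩ˢ-split Γ₁ Γ₂ S
  ... | split {j₁ = j₁} {j₂} {r₁} {r₂} S₁ S₂ e refl refl with ⊩M-sub g Ds S₂
  ... | upTo d e' =
    convE (⊩-cast (sym (+-interchange-+ k₁ k₂ j₁ j₂ (whiteCost c))) (sym (suc-interchange s₁ s₂ r₁ r₂))
                  (appr (⊩-sub g D S₁) d))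
          (≈E-trans (⊕-cong (≈E-refl _) e') (≈E-sym e))
  ⊩-sub g (conv D e l) S with ⊩ˢ-conv e S
  ... | upTo S' e₂ = conv (⊩-sub g D S') e₂ l
  ⊩M-sub g mnil S with ⊩ˢ-∅-inv S
  ... | refl , refl , refl = upTo mnil (≈E-refl _)
  ⊩M-sub g (mcons {Γ = Γ₁} {Δ = Γ₂} {k₁ = k₁} {k₂ = k₂} {s₁ = s₁} {s₂ = s₂} D Ds) S with ⊩ˢ-split Γ₁ Γ₂ S
  ... | split {j₁ = j₁} {j₂} {r₁} {r₂} S₁ S₂ e refl refl with ⊩M-sub g Ds S₂
  ... | upTo d e' =
    upTo (⊩M-cast (sym (+-interchange k₁ k₂ j₁ j₂)) (sym (+-interchange s₁ s₂ r₁ r₂)) (mcons (⊩-sub g D S₁) d))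
         (≈E-trans (⊕-cong (≈E-refl _) e') (≈E-sym e))

IsRenaming : ∀ {m n} → (Fin m → Term n) → Set
IsRenaming {m} {n} σ = ∀ i → Σ[ y ∈ Fin n ] σ i ≡ var y

isRenaming-exts : ∀ {m n} {σ : Fin m → Term n} → IsRenaming σ → IsRenaming (exts σ)
isRenaming-exts g F.zero = F.zero , refl
isRenaming-exts g (F.suc i) with g i
... | y , e = F.suc y , cong (ren F.suc) e

⊩M-var-wk : ∀ {n} {Δ : Env n} {y M k s} → Δ ⊩M var y ∶ M [ k , s ] → ⊩M-UpTo ([] ∷ Δ) (var (F.suc y)) M k s
⊩M-var-wk {y = y} {M} D with ⊩M-var-inv D
... | refl , refl , e = upTo (⊩M-var (F.suc y) M) (≈M-refl [] ∷ ≈E-sym e)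

isRenaming-wk : ∀ {m n} {σ : Fin m → Term n} {Γ Δ j r} → IsRenaming σ → Δ ⊩ˢ σ ∶ Γ [ j , r ] →
                ⊩ˢ-UpTo ([] ∷ Δ) (λ i → ren F.suc (σ i)) Γ j r
isRenaming-wk g snil = upTo snil (≈E-refl _)
isRenaming-wk g (scons D S) with g F.zero
... | y , e with ⊩M-var-wk (⊩M-castT e D)
... | upTo d e' with isRenaming-wk (λ i → g (F.suc i)) S
... | upTo S' e'' = upTo (scons (⊩M-castT (sym (cong (ren F.suc) e)) d) S') (⊕-cong e' e'')

module RenamingLemma = SubstitutionLemma IsRenaming isRenaming-exts isRenaming-wk

⊩-ren : ∀ {m n} (ρ : Fin m → Fin n) {Γ t L k s} →
        Γ ⊩ t ∶ L [ k , s ] → renEnv ρ Γ ⊩ ren ρ t ∶ L [ k , s ]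
⊩-ren ρ {Γ} {t} {k = k} {s} D =
  ⊩-castT (sym (ren-sub ρ t))
    (⊩-cast (+-identityʳ k) (+-identityʳ s) (RenamingLemma.⊩-sub (λ i → ρ i , refl) D (⊩ˢ-var ρ Γ)))

⊩-wk : ∀ {n} {Γ : Env n} {t L k s} → Γ ⊩ t ∶ L [ k , s ] → ([] ∷ Γ) ⊩ ren F.suc t ∶ L [ k , s ]
⊩-wk {Γ = Γ} D = ⊩-castE (≡-trans (renEnv-suc (λ i → i) Γ) (cong ([] ∷_) (renEnv-id Γ))) (⊩-ren F.suc D)

⊩M-wk : ∀ {n} {Γ : Env n} {t M k s} → Γ ⊩M t ∶ M [ k , s ] → ([] ∷ Γ) ⊩M ren F.suc t ∶ M [ k , s ]
⊩M-wk mnil = mnil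
⊩M-wk (mcons D Ds) = mcons (⊩-wk D) (⊩M-wk Ds)

⊩ˢ-wk : ∀ {m n} {σ : Fin m → Term n} {Γ Δ j r} → Δ ⊩ˢ σ ∶ Γ [ j , r ] →
        ⊩ˢ-UpTo ([] ∷ Δ) (λ i → ren F.suc (σ i)) Γ j r
⊩ˢ-wk snil = upTo snil (≈E-refl _)
⊩ˢ-wk (scons D S) with ⊩ˢ-wk S
... | upTo S' e = upTo (scons (⊩M-wk D) S') (⊕-cong (≈E-refl _) e)

⊩-sub : ∀ {m n} {σ : Fin m → Term n} {Γ t L k s Δ j r} →
        Γ ⊩ t ∶ L [ k , s ] → Δ ⊩ˢ σ ∶ Γ [ j , r ] → Δ ⊩ sub σ t ∶ L [ k + j , s + r ]
⊩-sub = SubstitutionLemma.⊩-sub (λ _ → ⊤) (λ _ → tt) (λ _ → ⊩ˢ-wk) tt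

⊩-[]₀ : ∀ {n} {Γ Δ : Env n} {b : Term (suc n)} {a M L k s j r} →
        (M ∷ Γ) ⊩ b ∶ L [ k , s ] → Δ ⊩M a ∶ M [ j , r ] → (Γ ⊕ Δ) ⊩ (b [ a ]₀) ∶ L [ k + j , s + r ]
⊩-[]₀ {Γ = Γ} {Δ} {k = k} {s} {j} {r} D Da =
  convE (⊩-cast (cong (k +_) (+-identityʳ j)) (cong (s +_) (+-identityʳ r)) (⊩-sub D (scons Da (⊩ˢ-var (λ i → i) Γ))))
        (≈E-trans (≈E-reflexive (cong (Δ ⊕_) (renEnv-id Γ))) (⊕-comm Δ Γ))

-- Anti-substitution

record SubInv {m n} (σ : Fin m → Term n) (t : Term m) (Δ : Env n) (L : Ty) (k : ℕ) : Set where
  constructor subInv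
  field
    {Γ} : Env m
    {Δ'} : Env n
    {k₀ s₀ j r} : ℕ
    d : Γ ⊩ t ∶ L [ k₀ , s₀ ]
    S : Δ' ⊩ˢ σ ∶ Γ [ j , r ]
    e : Δ' ≈E Δ
    ek : k ≡ k₀ + j

record SubInvM {m n} (σ : Fin m → Term n) (t : Term m) (Δ : Env n) (M : MTy) (k : ℕ) : Set where
  constructor subInvM
  field
    {Γ} : Env m
    {Δ'} : Env n
    {k₀ s₀ j r} : ℕ
    d : Γ ⊩M t ∶ M [ k₀ , s₀ ]
    S : Δ' ⊩ˢ σ ∶ Γ [ j , r ]
    e : Δ' ≈E Δ
    ek : k ≡ k₀ + j

record Strengthening {m n} (σ : Fin m → Term n) (Γ : Env m) (E : Env (suc n)) (j : ℕ) : Set where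
  constructor strengthening
  field
    {E'} : Env n
    {r'} : ℕ
    S : E' ⊩ˢ σ ∶ Γ [ j , r' ]
    e : E ≈E ([] ∷ E')

-- As for the substitution lemma, the class of substitutions is a parameter:
-- strengthening a typing of a renamed term is itself an instance at renamings.
module AntiSubstitutionLemma
  (Admissible : ∀ {m n} → (Fin m → Term n) → Set)
  (admissible-exts : ∀ {m n} {σ : Fin m → Term n} → Admissible σ → Admissible (exts σ))
  (admissible-strengthen : ∀ {m n} {σ : Fin m → Term n} {Γ E j r} → Admissible σ →
                           E ⊩ˢ (λ i → ren F.suc (σ i)) ∶ Γ [ j , r ] → Strengthening σ Γ E j) where

  ⊩-sub-inv : ∀ {m n} {σ : Fin m → Term n} {Δ L k s} → Admissible σ → ∀ t → Δ ⊩ sub σ t ∶ L [ k , s ] → SubInv σ t Δ L k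
  ⊩M-sub-inv : ∀ {m n} {σ : Fin m → Term n} {Δ M k s} → Admissible σ → ∀ t → Δ ⊩M sub σ t ∶ M [ k , s ] → SubInvM σ t Δ M k
  ⊩-sub-inv {k = k} {s = s} g (var i) D with ⊩ˢ-single i (⊩M-cast (+-identityʳ k) (+-identityʳ s) (mcons D mnil))
  ... | upTo S e = subInv (ax i _) S (≈E-trans e (≈E-reflexive (⊕-identityʳ _))) refl
  ⊩-sub-inv g (lam b) D with ⊩-lam-inv D
  ... | lamInv {M = M} eL d es with ⊩-sub-inv (admissible-exts g) b d
  ... | subInv {Γ = N ∷ Γ'} d' (scons D₀ Sr) e ek with ⊩M-var-inv D₀ | admissible-strengthen g Sr
  ... | refl , refl , e₀ | strengthening {E'} S' e₁ with
          ≈E-trans (≈E-reflexive (sym (cong₂ _∷_ (List.++-identityʳ N) (⊕-identityˡ E'))))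
                   (≈E-trans (⊕-cong (≈E-sym e₀) (≈E-sym e₁)) e)
  ... | eN ∷ eE' = subInv (convT (abs d') (≈T-trans (arr eN (≈T-refl _)) (≈T-sym eL))) S' eE' ek
  ⊩-sub-inv g (app a b) D with ⊩-app-inv D
  ... | appInv da db eΔ ek es with ⊩-sub-inv g a da | ⊩M-sub-inv g b db
  ... | subInv {k₀ = ka} {j = ja} d₁ S₁ e₁ refl | subInvM {k₀ = kb} {j = jb} d₂ S₂ e₂ refl with ⊩ˢ-merge S₁ S₂
  ... | upTo S e = subInv (appr d₁ d₂) S (≈E-trans e (≈E-trans (⊕-cong e₁ e₂) (≈E-sym eΔ)))
                     (≡-trans ek (sym (+-interchange-+ ka kb ja jb (whiteCost _))))
  ⊩M-sub-inv {σ = σ} g t mnil = subInvM mnil (⊩ˢ-∅ σ) (≈E-refl _) refl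
  ⊩M-sub-inv g t (mcons D Ds) with ⊩-sub-inv g t D | ⊩M-sub-inv g t Ds
  ... | subInv {k₀ = ka} {j = ja} d₁ S₁ e₁ refl | subInvM {k₀ = kb} {j = jb} d₂ S₂ e₂ refl with ⊩ˢ-merge S₁ S₂
  ... | upTo S e = subInvM (mcons d₁ d₂) S (≈E-trans e (⊕-cong e₁ e₂)) (+-interchange ka ja kb jb)

isRenaming-strengthen : ∀ {m n} {σ : Fin m → Term n} {Γ E j r} → IsRenaming σ →
                        E ⊩ˢ (λ i → ren F.suc (σ i)) ∶ Γ [ j , r ] → Strengthening σ Γ E j
isRenaming-strengthen g snil = strengthening snil (≈E-refl _)
isRenaming-strengthen g (scons {M = M} D S) with g F.zero | isRenaming-strengthen (λ i → g (F.suc i)) S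
... | y , e | strengthening S' e' with ⊩M-var-inv (⊩M-castT (cong (ren F.suc) e) D)
... | refl , refl , e'' = strengthening (scons (⊩M-castT (sym e) (⊩M-var y M)) S') (⊕-cong e'' e')

module AntiRenamingLemma = AntiSubstitutionLemma IsRenaming isRenaming-exts isRenaming-strengthen

record RenInv {m n} (ρ : Fin m → Fin n) (t : Term m) (E : Env n) (L : Ty) (k : ℕ) : Set where
  constructor renInv
  field
    {Γ} : Env m
    {s} : ℕ
    d : Γ ⊩ t ∶ L [ k , s ]
    e : E ≈E renEnv ρ Γ

⊩-ren-inv : ∀ {m n} (ρ : Fin m → Fin n) t {E L k s} → E ⊩ ren ρ t ∶ L [ k , s ] → RenInv ρ t E L k
⊩-ren-inv ρ t D with AntiRenamingLemma.⊩-sub-inv (λ i → ρ i , refl) t (⊩-castT (ren-sub ρ t) D)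
... | subInv d S e ek with ⊩ˢ-var-inv ρ S
... | e' , refl = renInv (⊩-cast (≡-trans (sym (+-identityʳ _)) (sym ek)) refl d) (≈E-trans (≈E-sym e) e')

⊩M-wk-inv : ∀ p {n} (u : Term n) {E M k s} → E ⊩M wk p u ∶ M [ k , s ] →
            Σ[ G ∈ Env n ] Σ[ s' ∈ ℕ ] (G ⊩M u ∶ M [ k , s' ]) × (E ≈E (∅ {p} ++ G))
⊩M-wk-inv p u mnil = ∅ , 0 , mnil , ≈E-reflexive (sym (∅++∅ p))
⊩M-wk-inv p u (mcons D Ds) with ⊩-ren-inv (p ↑ʳ_) u D | ⊩M-wk-inv p u Ds
... | renInv {G₁} d e | G₂ , _ , d' , e' =
  G₁ ⊕ G₂ , _ , mcons d d' ,
  ≈E-trans (⊕-cong (≈E-trans e (≈E-reflexive (renEnv-↑ʳ p G₁))) e')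
           (≈E-reflexive (≡-trans (++-⊕ ∅ ∅ G₁ G₂) (cong (_++ (G₁ ⊕ G₂)) ∅⊕∅)))

⊩ˢ-strengthen : ∀ {m n} {σ : Fin m → Term n} {Γ E j r} →
                E ⊩ˢ (λ i → ren F.suc (σ i)) ∶ Γ [ j , r ] → Strengthening σ Γ E j
⊩ˢ-strengthen snil = strengthening snil (≈E-refl _)
⊩ˢ-strengthen {σ = σ} (scons D S) with ⊩ˢ-strengthen S | ⊩M-wk-inv 1 (σ F.zero) D
... | strengthening S' e' | _ , _ , d₀ , e₀ = strengthening (scons d₀ S') (⊕-cong e₀ e')

⊩-β-expansion : ∀ {n} {Δ : Env n} (b : Term (suc n)) (a : Term n) {L k s} →
                Δ ⊩ (b [ a ]₀) ∶ L [ k , s ] → Σ[ s' ∈ ℕ ] (Δ ⊩ app (lam b) a ∶ L [ k , s' ])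
⊩-β-expansion b a D with AntiSubstitutionLemma.⊩-sub-inv (λ _ → ⊤) (λ _ → tt) (λ _ → ⊩ˢ-strengthen) tt b D
... | subInv {Γ = M ∷ Γ} {k₀ = k₀} d (scons {Δ₁ = Θ} {k₁ = k₁} Da S) e refl with ⊩ˢ-var-inv (λ i → i) S
... | e' , refl =
  _ , convE (⊩-cast (≡-trans (+-identityʳ _) (cong (k₀ +_) (sym (+-identityʳ k₁)))) refl (appr (abs d) Da))
            (≈E-trans (≈E-trans (⊕-comm Γ Θ) (⊕-cong (≈E-refl Θ) (≈E-sym (≈E-trans e' (≈E-reflexive (renEnv-id Γ)))))) e)

-- Subject reduction and expansion

⊩-β-reduction : ∀ {n} {Δ : Env n} {b a L k s} → Δ ⊩ app (lam b) a ∶ L [ k , s ] →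
                Σ[ s' ∈ ℕ ] (suc s' < s) × (Δ ⊩ (b [ a ]₀) ∶ L [ k , s' ])
⊩-β-reduction D with ⊩-app-inv D
... | appInv {k₁ = k₁} {k₂ = k₂} {s₂ = s₂} da db eΔ refl refl with ⊩-lam-inv da
... | lamInv {s₀ = s₀} (arr m l) d refl =
  s₀ + s₂ , ≤-refl ,
  convE (⊩-cast (sym (+-identityʳ (k₁ + k₂))) refl (⊩-[]₀ (conv d (≈M-sym m ∷ ≈E-refl _) (≈T-sym l)) db)) (≈E-sym eΔ)

⊩-⟶β : ∀ {n} {t t' : Term n} {Δ L k s} → t ⟶β t' → Δ ⊩ t ∶ L [ k , s ] →
       Σ[ s' ∈ ℕ ] (s' ≤ s) × (Δ ⊩ t' ∶ L [ k , s' ])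
⊩M-⟶β : ∀ {n} {t t' : Term n} {Δ M k s} → t ⟶β t' → Δ ⊩M t ∶ M [ k , s ] →
        Σ[ s' ∈ ℕ ] (s' ≤ s) × (Δ ⊩M t' ∶ M [ k , s' ])
⊩-⟶β β D with ⊩-β-reduction D
... | s' , lt , d = s' , ≤-trans (n≤1+n _) (≤-trans (n≤1+n _) lt) , d
⊩-⟶β (ξlam st) D with ⊩-lam-inv D
... | lamInv eL d refl with ⊩-⟶β st d
... | s' , le , d' = suc s' , s≤s le , convT (abs d') (≈T-sym eL)
⊩-⟶β (ξl st) D with ⊩-app-inv D
... | appInv da db eΔ refl refl with ⊩-⟶β st da
... | s' , le , d' = _ , s≤s (+-mono-≤ le ≤-refl) , convE (appr d' db) (≈E-sym eΔ)
⊩-⟶β (ξr st) D with ⊩-app-inv D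
... | appInv da db eΔ refl refl with ⊩M-⟶β st db
... | s' , le , d' = _ , s≤s (+-mono-≤ ≤-refl le) , convE (appr da d') (≈E-sym eΔ)
⊩M-⟶β st mnil = 0 , z≤n , mnil
⊩M-⟶β st (mcons D Ds) with ⊩-⟶β st D | ⊩M-⟶β st Ds
... | s₁ , le₁ , d₁ | s₂ , le₂ , d₂ = _ , +-mono-≤ le₁ le₂ , mcons d₁ d₂

⊩-⟶β* : ∀ {n} {t t' : Term n} {Δ L k s} → t ⟶β* t' → Δ ⊩ t ∶ L [ k , s ] →
        Σ[ s' ∈ ℕ ] (s' ≤ s) × (Δ ⊩ t' ∶ L [ k , s' ])
⊩-⟶β* ε D = _ , ≤-refl , D
⊩-⟶β* (st ◅ sts) D with ⊩-⟶β st D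
... | s₁ , le₁ , d₁ with ⊩-⟶β* sts d₁
... | s₂ , le₂ , d₂ = s₂ , ≤-trans le₂ le₁ , d₂

⊩-⟵β : ∀ {n} {t t' : Term n} {Δ L k s} → t ⟶β t' → Δ ⊩ t' ∶ L [ k , s ] → Σ[ s' ∈ ℕ ] (Δ ⊩ t ∶ L [ k , s' ])
⊩M-⟵β : ∀ {n} {t t' : Term n} {Δ M k s} → t ⟶β t' → Δ ⊩M t' ∶ M [ k , s ] → Σ[ s' ∈ ℕ ] (Δ ⊩M t ∶ M [ k , s' ])
⊩-⟵β (β {t = b} {u = a}) D = ⊩-β-expansion b a D
⊩-⟵β (ξlam st) D with ⊩-lam-inv D
... | lamInv eL d refl with ⊩-⟵β st d
... | _ , d' = _ , convT (abs d') (≈T-sym eL)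
⊩-⟵β (ξl st) D with ⊩-app-inv D
... | appInv da db eΔ refl refl with ⊩-⟵β st da
... | _ , d' = _ , convE (appr d' db) (≈E-sym eΔ)
⊩-⟵β (ξr st) D with ⊩-app-inv D
... | appInv da db eΔ refl refl with ⊩M-⟵β st db
... | _ , d' = _ , convE (appr da d') (≈E-sym eΔ)
⊩M-⟵β st mnil = 0 , mnil
⊩M-⟵β st (mcons D Ds) with ⊩-⟵β st D | ⊩M-⟵β st Ds
... | _ , d₁ | _ , d₂ = _ , mcons d₁ d₂

⊩-⟵β* : ∀ {n} {t t' : Term n} {Δ L k s} → t ⟶β* t' → Δ ⊩ t' ∶ L [ k , s ] → Σ[ s' ∈ ℕ ] (Δ ⊩ t ∶ L [ k , s' ])
⊩-⟵β* ε D = _ , D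
⊩-⟵β* (st ◅ sts) D with ⊩-⟵β* sts D
... | _ , d₁ = ⊩-⟵β st d₁

-- Head normal forms

infixr 5 _⇛_ _⇛•_

_⇛_ : ∀ {k} → Vec (MTy × Col) k → Ty → Ty
[] ⇛ L = L
((M , c) ∷ Mcs) ⇛ L = M ⇒⟨ c ⟩ (Mcs ⇛ L)

_⇛•_ : ∀ {k} → Vec MTy k → Ty → Ty
[] ⇛• L = L
(M ∷ Ms) ⇛• L = M ⇒⟨ black ⟩ (Ms ⇛• L)

⇛-++ : ∀ {k p} (A : Vec (MTy × Col) k) (B : Vec (MTy × Col) p) L → (A ++ B) ⇛ L ≡ A ⇛ B ⇛ L
⇛-++ [] B L = refl
⇛-++ ((M , c) ∷ A) B L = cong (M ⇒⟨ c ⟩_) (⇛-++ A B L)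

-- The type of lams j b when b is typed in Ns ++ Γ: the head of Ns is the
-- innermost abstraction, so the arrows come in reverse order.
absType : ∀ {j} → Vec MTy j → Ty → Ty
absType [] T = T
absType (M ∷ Ms) T = absType Ms (M ⇒⟨ black ⟩ T)

absType-cong : ∀ {j} {Ms Ms' : Vec MTy j} {T T'} → Ms ≈E Ms' → T ≈T T' → absType Ms T ≈T absType Ms' T'
absType-cong [] e = e
absType-cong (m ∷ ms) e = absType-cong ms (arr m e)

absType-∷ʳ : ∀ {p} (X : Vec MTy p) B T → absType (X ∷ʳ B) T ≡ (B ⇒⟨ black ⟩ absType X T)
absType-∷ʳ [] B T = refl
absType-∷ʳ (x ∷ X) B T = absType-∷ʳ X B (x ⇒⟨ black ⟩ T)

absType-opposite : ∀ {q} (Bs : Vec MTy q) T → absType (renEnv F.opposite Bs) T ≡ Bs ⇛• T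
absType-opposite [] T = refl
absType-opposite (B ∷ Bs) T =
  ≡-trans (cong (λ X → absType X T) (renEnv-opposite B Bs))
  (≡-trans (absType-∷ʳ (renEnv F.opposite Bs) B T) (cong (B ⇒⟨ black ⟩_) (absType-opposite Bs T)))

⊩-lams : ∀ {m} j {Γ : Env m} (Ns : Vec MTy j) {b T k s} →
         (Ns ++ Γ) ⊩ b ∶ T [ k , s ] → Γ ⊩ lams j b ∶ absType Ns T [ k , j + s ]
⊩-lams zero [] D = D
⊩-lams (suc j) (M ∷ Ns) {s = s} D = ⊩-cast refl (+-suc j s) (⊩-lams j Ns (abs D))

record LamsInv {m} (j : ℕ) (Γ : Env m) (b : Term (j + m)) (L : Ty) (k s : ℕ) : Set where
  constructor lamsInv
  field
    {Ns} : Vec MTy j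
    {T} : Ty
    {s₀} : ℕ
    eL : L ≈T absType Ns T
    d : (Ns ++ Γ) ⊩ b ∶ T [ k , s₀ ]
    es : s ≡ j + s₀

⊩-lams-inv : ∀ {m} j {Γ : Env m} (b : Term (j + m)) {L k s} → Γ ⊩ lams j b ∶ L [ k , s ] → LamsInv j Γ b L k s
⊩-lams-inv zero b D = lamsInv (≈T-refl _) D refl
⊩-lams-inv (suc j) b D with ⊩-lams-inv j (lam b) D
... | lamsInv {Ns} eL d refl with ⊩-lam-inv d
... | lamInv {s₀ = s₀} eL' d' refl = lamsInv (≈T-trans eL (absType-cong (≈E-refl Ns) eL')) d' (+-suc j s₀)

data Spine {n} : ∀ {k} → Env n → Vec (Term n) k → Vec (MTy × Col) k → ℕ → ℕ → Set where
  []  : Spine ∅ [] [] 0 0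
  _∷_ : ∀ {k} {Δ₁ Δ₂ : Env n} {a} {as : Vec (Term n) k} {M c Mcs k₁ k₂ s₁ s₂} →
        Δ₁ ⊩M a ∶ M [ k₁ , s₁ ] → Spine Δ₂ as Mcs k₂ s₂ →
        Spine (Δ₁ ⊕ Δ₂) (a ∷ as) ((M , c) ∷ Mcs) (k₁ + k₂ + whiteCost c) (suc (s₁ + s₂))

+-spine-cost : ∀ h a b w → h + a + w + b ≡ h + (a + b + w)
+-spine-cost = solve-∀

+-spine-size : ∀ h a b → suc (h + a) + b ≡ h + suc (a + b)
+-spine-size = solve-∀

⊩-apps : ∀ {n k} {Δh Δa : Env n} {h} {as : Vec (Term n) k} {Mcs L kh sh ka sa} →
         Δh ⊩ h ∶ Mcs ⇛ L [ kh , sh ] → Spine Δa as Mcs ka sa → (Δh ⊕ Δa) ⊩ apps h as ∶ L [ kh + ka , sh + sa ]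
⊩-apps {Δh = Δh} {kh = kh} {sh} D [] =
  ⊩-castE (sym (⊕-identityʳ Δh)) (⊩-cast (sym (+-identityʳ kh)) (sym (+-identityʳ sh)) D)
⊩-apps {Δh = Δh} {kh = kh} {sh} D (_∷_ {Δ₁ = Δ₁} {Δ₂ = Δ₂} {c = c} {k₁ = k₁} {k₂ = k₂} {s₁ = s₁} {s₂ = s₂} d sp) =
  ⊩-castE (⊕-assoc Δh Δ₁ Δ₂) (⊩-cast (+-spine-cost kh k₁ k₂ (whiteCost c)) (+-spine-size sh s₁ s₂) (⊩-apps (appr D d) sp))

record AppsInv {n k} (Δ : Env n) (h : Term n) (as : Vec (Term n) k) (L : Ty) (kk s : ℕ) : Set where
  constructor appsInv
  field
    {Δh Δa} : Env n
    {Mcs} : Vec (MTy × Col) k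
    {kh ka sh sa} : ℕ
    dh : Δh ⊩ h ∶ Mcs ⇛ L [ kh , sh ]
    sp : Spine Δa as Mcs ka sa
    eΔ : Δ ≈E (Δh ⊕ Δa)
    ek : kk ≡ kh + ka
    es : s ≡ sh + sa

⊩-apps-inv : ∀ {n k} {Δ : Env n} {h} (as : Vec (Term n) k) {L kk s} →
             Δ ⊩ apps h as ∶ L [ kk , s ] → AppsInv Δ h as L kk s
⊩-apps-inv {Δ = Δ} [] {kk = kk} {s} D =
  appsInv D [] (≈E-reflexive (sym (⊕-identityʳ Δ))) (sym (+-identityʳ kk)) (sym (+-identityʳ s))
⊩-apps-inv (a ∷ as) D with ⊩-apps-inv as D
... | appsInv {Δa = Δa} {ka = ka} {sa = sa} dh sp eΔ refl refl with ⊩-app-inv dh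
... | appInv {Δ₁ = Δ₁} {Δ₂ = Δ₂} {c = c} {k₁ = k₁} {k₂ = k₂} {s₁ = s₁} {s₂ = s₂} da db eΔ' refl refl =
  appsInv da (db ∷ sp) (≈E-trans eΔ (≈E-trans (⊕-cong eΔ' (≈E-refl Δa)) (≈E-reflexive (⊕-assoc Δ₁ Δ₂ Δa))))
    (+-spine-cost k₁ k₂ ka (whiteCost c)) (+-spine-size s₁ s₂ sa)

record SpineSplit {n k p} (Δ : Env n) (xs : Vec (Term n) k) (ys : Vec (Term n) p)
                  (Mcs : Vec (MTy × Col) (k + p)) (kk s : ℕ) : Set where
  constructor spineSplit
  field
    {Δ₁ Δ₂} : Env n
    {Mcs₁} : Vec (MTy × Col) k
    {Mcs₂} : Vec (MTy × Col) p
    {k₁ k₂ s₁ s₂} : ℕ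
    sp₁ : Spine Δ₁ xs Mcs₁ k₁ s₁
    sp₂ : Spine Δ₂ ys Mcs₂ k₂ s₂
    eM : Mcs ≡ Mcs₁ ++ Mcs₂
    eΔ : Δ ≡ (Δ₁ ⊕ Δ₂)
    ek : kk ≡ k₁ + k₂
    es : s ≡ s₁ + s₂

+-spine-cost-assoc : ∀ a b c w → a + (b + c) + w ≡ a + b + w + c
+-spine-cost-assoc = solve-∀

+-spine-size-assoc : ∀ a b c → suc (a + (b + c)) ≡ suc (a + b) + c
+-spine-size-assoc = solve-∀

spine-split : ∀ {n k p} {Δ : Env n} (xs : Vec (Term n) k) {ys : Vec (Term n) p} {Mcs kk s} →
              Spine Δ (xs ++ ys) Mcs kk s → SpineSplit Δ xs ys Mcs kk s
spine-split [] sp = spineSplit [] sp refl (sym (⊕-identityˡ _)) refl refl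
spine-split (x ∷ xs) (_∷_ {Δ₁ = E} {c = c} {k₁ = a} {s₁ = b} d sp) with spine-split xs sp
... | spineSplit {Δ₁} {Δ₂} {k₁ = k₁} {k₂} {s₁} {s₂} sp₁ sp₂ refl refl refl refl =
  spineSplit (d ∷ sp₁) sp₂ refl (sym (⊕-assoc E Δ₁ Δ₂)) (+-spine-cost-assoc a k₁ k₂ (whiteCost c)) (+-spine-size-assoc b s₁ s₂)

lams-cong : ∀ {m} j {t t' : Term (j + m)} → t ⟶β t' → lams j t ⟶β lams j t'
lams-cong zero st = st
lams-cong (suc j) st = lams-cong j (ξlam st)

apps-cong : ∀ {n k} {t t' : Term n} (as : Vec (Term n) k) → t ⟶β t' → apps t as ⟶β apps t' as
apps-cong [] st = st
apps-cong (a ∷ as) st = apps-cong as (ξl st)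

-- Head reduction strictly decreases the size of a typing, which is the fuel b.
lams-apps-hasHNF : ∀ (b : ℕ) {m} (j : ℕ) (h : Term (j + m)) {k} (as : Vec (Term (j + m)) k) {Δ L c s} →
                   Δ ⊩ lams j (apps h as) ∶ L [ c , s ] → s < b → HasHNF (lams j (apps h as))
lams-apps-hasHNF b j (var y) as D lt = j , _ , y , as , ε
lams-apps-hasHNF b j (app f a) as D lt = lams-apps-hasHNF b j f (a ∷ as) D lt
lams-apps-hasHNF b j (lam h) [] D lt = lams-apps-hasHNF b (suc j) h [] D lt
lams-apps-hasHNF (suc b) j (lam h) (a ∷ as) D (s≤s lt) with ⊩-lams-inv j _ D
... | lamsInv {Ns} eL d refl with ⊩-apps-inv as d
... | appsInv dh sp eΔ refl refl with ⊩-β-reduction dh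
... | s' , lt' , d' with lams-apps-hasHNF b j (h [ a ]₀) as
        (convT (⊩-lams j Ns (convE (⊩-apps d' sp) (≈E-sym eΔ))) (≈T-sym eL))
        (<-≤-trans (+-monoʳ-< j (+-monoˡ-< _ (<-≤-trans (n≤1+n _) lt'))) lt)
... | J , K , y , bs , red = J , K , y , bs , (lams-cong j (apps-cong as β) ◅ red)

⊩⇒hasHNF : ∀ {m} {t : Term m} {Δ L k s} → Δ ⊩ t ∶ L [ k , s ] → HasHNF t
⊩⇒hasHNF {t = t} {s = s} D = lams-apps-hasHNF (suc s) 0 t [] D ≤-refl

-- Whitening

Wh-cast : ∀ {p k k' A B} → k ≡ k' → Wh p k A B → Wh p k' A B
Wh-cast refl w = w

WhL-cast : ∀ {p k k' A B} → k ≡ k' → WhL p k A B → WhL p k' A B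
WhL-cast refl w = w

WhM-cast : ∀ {p k k' A B} → k ≡ k' → WhM p k A B → WhM p k' A B
WhM-cast refl w = w

WhE-cast : ∀ {n p k k'} {A B : Env n} → k ≡ k' → WhE p k A B → WhE p k' A B
WhE-cast refl w = w

Wh-refl : ∀ p A → Wh p 0 A A
WhM-refl : ∀ p M → WhM p 0 M M
WhL-refl : ∀ p M → WhL p 0 M M
Wh-refl p (atom a) = atom
Wh-refl p (M ⇒⟨ c ⟩ L) = same (WhM-refl (neg p) M) (Wh-refl p L)
WhM-refl p M = perm refl (WhL-refl p M)
WhL-refl p [] = []
WhL-refl p (A ∷ M) = Wh-refl p A ∷ WhL-refl p M

WhE-refl : ∀ {n} p (Γ : Env n) → WhE p 0 Γ Γ
WhE-refl p [] = []
WhE-refl p (M ∷ Γ) = WhM-refl p M ∷ WhE-refl p Γ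

WhL-↭ : ∀ {p k N M Q} → WhL p k N M → M ↭ Q → Σ[ N' ∈ MTy ] (N ↭ N') × WhL p k N' Q
WhL-↭ {N = N} w refl = N , refl , w
WhL-↭ (w ∷ ws) (prep _ q) with WhL-↭ ws q
... | _ , r , ws' = _ , prep _ r , w ∷ ws'
WhL-↭ (_∷_ {k₁ = a} w₁ (_∷_ {k₁ = b} {k₂ = c} w₂ ws)) (swap _ _ q) with WhL-↭ ws q
... | _ , r , ws' = _ , swap _ _ r , WhL-cast (x∙yz≈y∙xz b a c) (w₂ ∷ (w₁ ∷ ws'))
WhL-↭ w (trans q₁ q₂) with WhL-↭ w q₁
... | _ , r₁ , w₁ with WhL-↭ w₁ q₂
... | N₂ , r₂ , w₂ = N₂ , trans r₁ r₂ , w₂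

Wh-respʳ-≈ : ∀ {p k A' A B} → Wh p k A' A → A ≈T B → Wh p k A' B
WhM-respʳ-≈ : ∀ {p k M' M N} → WhM p k M' M → M ≈M N → WhM p k M' N
WhL-respʳ-≈ : ∀ {p k M' M N} → WhL p k M' M → Pointwise _≈T_ M N → WhL p k M' N
Wh-respʳ-≈ atom atom = atom
Wh-respʳ-≈ (whten m l) (arr m' l') = whten (WhM-respʳ-≈ m m') (Wh-respʳ-≈ l l')
Wh-respʳ-≈ (same m l) (arr m' l') = same (WhM-respʳ-≈ m m') (Wh-respʳ-≈ l l')
WhM-respʳ-≈ (perm q w) (perm r rs) with WhL-↭ w r
... | _ , r' , w' = perm (trans q r') (WhL-respʳ-≈ w' rs)
WhL-respʳ-≈ [] [] = []
WhL-respʳ-≈ (w ∷ ws) (e ∷ es) = Wh-respʳ-≈ w e ∷ WhL-respʳ-≈ ws es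

Wh-respˡ-≈ : ∀ {p k A'' A' A} → A'' ≈T A' → Wh p k A' A → Wh p k A'' A
WhM-respˡ-≈ : ∀ {p k M'' M' M} → M'' ≈M M' → WhM p k M' M → WhM p k M'' M
WhL-respˡ-≈ : ∀ {p k M'' M' M} → Pointwise _≈T_ M'' M' → WhL p k M' M → WhL p k M'' M
Wh-respˡ-≈ atom atom = atom
Wh-respˡ-≈ (arr m l) (whten wm wl) = whten (WhM-respˡ-≈ m wm) (Wh-respˡ-≈ l wl)
Wh-respˡ-≈ (arr m l) (same wm wl) = same (WhM-respˡ-≈ m wm) (Wh-respˡ-≈ l wl)
WhM-respˡ-≈ (perm r rs) (perm q w) with Pointwise-↭ rs q
... | _ , r' , rs' = perm (trans r r') (WhL-respˡ-≈ rs' w)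
WhL-respˡ-≈ [] [] = []
WhL-respˡ-≈ (e ∷ es) (w ∷ ws) = Wh-respˡ-≈ e w ∷ WhL-respˡ-≈ es ws

WhE-respʳ-≈ : ∀ {n p k} {Γ' Γ Δ : Env n} → WhE p k Γ' Γ → Γ ≈E Δ → WhE p k Γ' Δ
WhE-respʳ-≈ [] [] = []
WhE-respʳ-≈ (w ∷ ws) (e ∷ es) = WhM-respʳ-≈ w e ∷ WhE-respʳ-≈ ws es

WhE-respˡ-≈ : ∀ {n p k} {Γ'' Γ' Γ : Env n} → Γ'' ≈E Γ' → WhE p k Γ' Γ → WhE p k Γ'' Γ
WhE-respˡ-≈ [] [] = []
WhE-respˡ-≈ (e ∷ es) (w ∷ ws) = WhM-respˡ-≈ e w ∷ WhE-respˡ-≈ es ws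

WhM-∷ : ∀ {p a b A' A M' M} → Wh p a A' A → WhM p b M' M → WhM p (a + b) (A' ∷ M') (A ∷ M)
WhM-∷ w (perm q wl) = perm (prep _ q) (w ∷ wl)

WhL-++ : ∀ {p a b M₁' M₁ M₂' M₂} → WhL p a M₁' M₁ → WhL p b M₂' M₂ → WhL p (a + b) (M₁' ++ₗ M₂') (M₁ ++ₗ M₂)
WhL-++ [] w = w
WhL-++ (_∷_ {k₁ = x} {k₂ = y} w ws) w' = WhL-cast (sym (+-assoc x y _)) (w ∷ WhL-++ ws w')

WhM-++ : ∀ {p a b M₁' M₁ M₂' M₂} → WhM p a M₁' M₁ → WhM p b M₂' M₂ → WhM p (a + b) (M₁' ++ₗ M₂') (M₁ ++ₗ M₂)
WhM-++ (perm q w) (perm q' w') = perm (Perm.++⁺ q q') (WhL-++ w w')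

WhE-⊕ : ∀ {n p a b} {Γ₁' Γ₁ Γ₂' Γ₂ : Env n} → WhE p a Γ₁' Γ₁ → WhE p b Γ₂' Γ₂ → WhE p (a + b) (Γ₁' ⊕ Γ₂') (Γ₁ ⊕ Γ₂)
WhE-⊕ [] [] = []
WhE-⊕ (_∷_ {k₁ = a} {k₂ = b} w ws) (_∷_ {k₁ = c} {k₂ = d} v vs) = WhE-cast (+-interchange a c b d) (WhM-++ w v ∷ WhE-⊕ ws vs)

WhE-single : ∀ {n p k M' M} (x : Fin n) → WhM p k M' M → WhE p k (single x M') (single x M)
WhE-single {k = k} F.zero w = WhE-cast (+-identityʳ k) (w ∷ WhE-refl _ ∅)
WhE-single (F.suc x) w = WhM-refl _ [] ∷ WhE-single x w

WhM-[]-inv : ∀ {p k M} → WhM p k [] M → (M ≡ []) × (k ≡ 0)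
WhM-[]-inv (perm q w) with Perm.↭-empty-inv (↭-sym q)
WhM-[]-inv (perm q []) | refl = refl , refl

WhE-∅-inv : ∀ {n p k} {Γ : Env n} → WhE p k ∅ Γ → (Γ ≡ ∅) × (k ≡ 0)
WhE-∅-inv [] = refl , refl
WhE-∅-inv (w ∷ ws) with WhM-[]-inv w | WhE-∅-inv ws
... | refl , refl | refl , refl = refl , refl

WhE-single-inv : ∀ {n p k M'} (x : Fin n) {Γ : Env n} → WhE p k (single x M') Γ →
                 Σ[ M ∈ MTy ] (Γ ≡ single x M) × WhM p k M' M
WhE-single-inv F.zero (w ∷ ws) with WhE-∅-inv ws
... | refl , refl = _ , refl , WhM-cast (sym (+-identityʳ _)) w
WhE-single-inv (F.suc x) (w ∷ ws) with WhM-[]-inv w | WhE-single-inv x ws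
... | refl , refl | M , refl , w' = M , refl , w'

WhE-++-inv : ∀ {j n p k} (A' : Vec MTy j) {A : Vec MTy j} {B' B : Env n} → WhE p k (A' ++ B') (A ++ B) →
             Σ[ k₁ ∈ ℕ ] Σ[ k₂ ∈ ℕ ] WhE p k₁ A' A × WhE p k₂ B' B × (k ≡ k₁ + k₂)
WhE-++-inv [] {[]} w = 0 , _ , [] , w , refl
WhE-++-inv (M' ∷ A') {M ∷ A} (_∷_ {k₁ = a} w ws) with WhE-++-inv A' {A} ws
... | k₁ , k₂ , w₁ , w₂ , refl = a + k₁ , k₂ , w ∷ w₁ , w₂ , sym (+-assoc a k₁ k₂)

WhE-∅++-inv : ∀ {j n p k} {G : Env n} {Δ : Env (j + n)} → WhE p k (∅ {j} ++ G) Δ →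
              Σ[ D ∈ Env n ] (Δ ≡ ∅ ++ D) × WhE p k G D
WhE-∅++-inv {zero} w = _ , refl , w
WhE-∅++-inv {suc j} (w ∷ ws) with WhM-[]-inv w | WhE-∅++-inv {j} ws
... | refl , refl | D , refl , w' = D , refl , w'

Wh-absType : ∀ {j kN kT} {Ns' Ns : Vec MTy j} {T' T} → WhE negv kN Ns' Ns → Wh pos kT T' T →
             Wh pos (kN + kT) (absType Ns' T') (absType Ns T)
Wh-absType [] w = w
Wh-absType {kT = kT} (_∷_ {k₁ = a} {k₂ = b} wm ws) w =
  Wh-cast (≡-trans (x∙yz≈y∙xz b a kT) (sym (+-assoc a b kT))) (Wh-absType ws (same wm w))

data WhSpine : ∀ {k} → ℕ → Vec (MTy × Col) k → Vec (MTy × Col) k → Set where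
  []  : WhSpine 0 [] []
  _∷_ : ∀ {k a b M' M c} {Mcs' Mcs : Vec (MTy × Col) k} →
        WhM pos a M' M → WhSpine b Mcs' Mcs → WhSpine (a + b) ((M' , c) ∷ Mcs') ((M , c) ∷ Mcs)

Wh-⇛ : ∀ {k d e} {Mcs' Mcs : Vec (MTy × Col) k} {T' T} → WhSpine d Mcs' Mcs → Wh negv e T' T →
       Wh negv (d + e) (Mcs' ⇛ T') (Mcs ⇛ T)
Wh-⇛ [] w = w
Wh-⇛ {e = e} (_∷_ {a = a} {b = b} wm ws) w = Wh-cast (sym (+-assoc a b e)) (same wm (Wh-⇛ ws w))

-- Simulation of t by u

record Simulation {m} (u : Term m) (Γ : Env m) (L : Ty) (k : ℕ) : Set where
  constructor simulation
  field
    {Γ'} : Env m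
    {L'} : Ty
    {k' s' dE dT} : ℕ
    d : Γ' ⊩ u ∶ L' [ k' , s' ]
    wE : WhE negv dE Γ' Γ
    wT : Wh pos dT L' L
    le : k' + (dE + dT) ≤ k

record SimulationM {m} (u : Term m) (Γ : Env m) (M : MTy) (k : ℕ) : Set where
  constructor simulationM
  field
    {Γ'} : Env m
    {M'} : MTy
    {k' s' dE dT} : ℕ
    d : Γ' ⊩M u ∶ M' [ k' , s' ]
    wE : WhE negv dE Γ' Γ
    wT : WhM pos dT M' M
    le : k' + (dE + dT) ≤ k

-- The arguments t₁ … t_k of the head normal form of t, typed in an environment
-- Δ over the p extra variables and the n + m others, simulated by u₁ … u_k.
-- The extra variables do not occur in the uᵢ, and whitening cannot create
-- types, so Δ is empty on them.
record SpineSimulation {p n k} (Δ : Env (p + n)) (us : Vec (Term n) k) (Mcs : Vec (MTy × Col) k) (c : ℕ) : Set where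
  constructor spineSimulation
  field
    {G D} : Env n
    {Mcs'} : Vec (MTy × Col) k
    {k' s' dE dT} : ℕ
    sp : Spine G us Mcs' k' s'
    eΔ : Δ ≡ (∅ {p} ++ D)
    wE : WhE negv dE G D
    wS : WhSpine dT Mcs' Mcs
    le : k' + (dE + dT) ≤ c

-- The extra arguments t_{k+1} … t_{k+p}, simulated by the variables f j.
record EtaSimulation {n q} (f : Fin q → Fin n) (Δ : Env n) (Mcs : Vec (MTy × Col) q) (c : ℕ) : Set where
  constructor etaSimulation
  field
    {Bs} : Vec MTy q
    {Mcs'} : Vec (MTy × Col) q
    {dT dW} : ℕ
    eΔ : Δ ≡ renEnv f Bs
    wS : WhSpine dT Mcs' Mcs
    wArrows : ∀ T → Wh pos dW (Mcs' ⇛ T) (Bs ⇛• T)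
    le : dT + dW ≤ c

record HnfTyping {m} (n p : ℕ) {k} (y : Fin (n + m)) (ts : Vec (Term (p + (n + m))) k)
                 (es : Vec (Term (p + (n + m))) p) (Γ : Env m) (L : Ty) (c s : ℕ) : Set where
  constructor hnfTyping
  field
    {Ns} : Vec MTy n
    {Ps} : Vec MTy p
    {T} : Ty
    {Δ₁ Δ₂} : Env (p + (n + m))
    {Mcs₁} : Vec (MTy × Col) k
    {Mcs₂} : Vec (MTy × Col) p
    {k₁ k₂ s₁ s₂} : ℕ
    eL : L ≈T absType Ns (absType Ps T)
    sp₁ : Spine Δ₁ ts Mcs₁ k₁ s₁
    sp₂ : Spine Δ₂ es Mcs₂ k₂ s₂
    eΔ : (Ps ++ (Ns ++ Γ)) ≈E (single (p ↑ʳ y) ((Mcs₁ ⇛ Mcs₂ ⇛ T) ∷ []) ⊕ (Δ₁ ⊕ Δ₂))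
    ec : c ≡ k₁ + k₂
    le : s₁ + s₂ ≤ s

⊩-hnf-inv : ∀ {m} n p {k} (y : Fin (n + m)) (ts : Vec (Term (p + (n + m))) k) (es : Vec (Term (p + (n + m))) p)
            {Γ L c s} → Γ ⊩ lams n (lams p (apps (var (p ↑ʳ y)) (ts ++ es))) ∶ L [ c , s ] →
            HnfTyping n p y ts es Γ L c s
⊩-hnf-inv n p y ts es D with ⊩-lams-inv n _ D
... | lamsInv {Ns} eL₁ d₁ refl with ⊩-lams-inv p _ d₁
... | lamsInv {Ps} eL₂ d₂ refl with ⊩-apps-inv (ts ++ es) d₂
... | appsInv {Δa = Δa} dh sp eΔ refl refl with ⊩-var-inv dh
... | refl , refl , eh with spine-split ts sp
... | spineSplit {Mcs₁ = Mcs₁} {Mcs₂} {s₁ = s₁} {s₂} sp₁ sp₂ refl refl refl refl =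
  hnfTyping {Ns = Ns} {Ps = Ps} (≈T-trans eL₁ (absType-cong (≈E-refl Ns) eL₂)) sp₁ sp₂
    (≈E-trans eΔ (⊕-cong (≈E-trans eh (single-cong _ (perm refl (≈T-reflexive (⇛-++ Mcs₁ Mcs₂ _) ∷ []))))
                         (≈E-refl Δa)))
    refl (≤-trans (m≤n+m (s₁ + s₂) p) (m≤n+m _ n))

hnf-env-split : ∀ {m n p} (y : Fin (n + m)) (Ps : Vec MTy p) (Ns : Vec MTy n) (Γ : Env m) T (D : Env (n + m)) (Bs : Vec MTy p) →
          (Ps ++ (Ns ++ Γ)) ≈E (single (p ↑ʳ y) (T ∷ []) ⊕ ((∅ {p} ++ D) ⊕ renEnv (λ j → F.opposite j ↑ˡ (n + m)) Bs)) →
          (Ps ≈E renEnv F.opposite Bs) × ((Ns ++ Γ) ≈E (single y (T ∷ []) ⊕ D))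
hnf-env-split {m} {n} {p} y Ps Ns Γ T D Bs e = ≈E-++ Ps RB (≈E-trans e (≈E-reflexive shape))
  where
  RB = renEnv F.opposite Bs
  Y = single y (T ∷ [])
  shape : (single (p ↑ʳ y) (T ∷ []) ⊕ ((∅ {p} ++ D) ⊕ renEnv (λ j → F.opposite j ↑ˡ (n + m)) Bs)) ≡ (RB ++ (Y ⊕ D))
  shape = begin
    single (p ↑ʳ y) (T ∷ []) ⊕ ((∅ {p} ++ D) ⊕ renEnv (λ j → F.opposite j ↑ˡ (n + m)) Bs)
      ≡⟨ cong₂ (λ X Z → X ⊕ ((∅ {p} ++ D) ⊕ Z)) (single-↑ʳ p y (T ∷ [])) (renEnv-↑ˡ (n + m) F.opposite Bs) ⟩
    (∅ {p} ++ Y) ⊕ ((∅ {p} ++ D) ⊕ (RB ++ ∅))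
      ≡⟨ cong ((∅ {p} ++ Y) ⊕_) (++-⊕ ∅ RB D ∅) ⟩
    (∅ {p} ++ Y) ⊕ ((∅ ⊕ RB) ++ (D ⊕ ∅))
      ≡⟨ ++-⊕ ∅ (∅ ⊕ RB) Y (D ⊕ ∅) ⟩
    (∅ ⊕ (∅ ⊕ RB)) ++ (Y ⊕ (D ⊕ ∅))
      ≡⟨ cong₂ _++_ (≡-trans (⊕-identityˡ _) (⊕-identityˡ RB)) (cong (Y ⊕_) (⊕-identityʳ D)) ⟩
    RB ++ (Y ⊕ D) ∎
    where open ≡-Reasoning

cost-hnf : ∀ {k' kA kB dW t₁ t₂ e₁ k₁ k₂} → t₁ + (t₂ + 0) + 0 + e₁ ≡ kA + kB →
           k' + (e₁ + t₁) ≤ k₁ → t₂ + dW ≤ k₂ → k' + (kB + (kA + dW)) ≤ k₁ + k₂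
cost-hnf {k'} {kA} {kB} {dW} {t₁} {t₂} {e₁} {k₁} {k₂} eq le₁ le₂ = begin
  k' + (kB + (kA + dW))                     ≡⟨ cong (k' +_) (regroup kA kB dW) ⟩
  k' + ((kA + kB) + dW)                     ≡⟨ cong (λ x → k' + (x + dW)) (sym eq) ⟩
  k' + ((t₁ + (t₂ + 0) + 0 + e₁) + dW)      ≡⟨ redistribute k' t₁ t₂ e₁ dW ⟩
  (k' + (e₁ + t₁)) + (t₂ + dW)              ≤⟨ +-mono-≤ le₁ le₂ ⟩
  k₁ + k₂                                   ∎
  where
  open ≤-Reasoning
  regroup : ∀ a b c → b + (a + c) ≡ (a + b) + c
  regroup = solve-∀
  redistribute : ∀ k a b e w → k + ((a + (b + 0) + 0 + e) + w) ≡ (k + (e + a)) + (b + w)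
  redistribute = solve-∀

-- The head variable keeps its colours and only its argument types are whitened;
-- the extra abstractions of t become the remaining arrows of u's head.
simulate-hnf : ∀ {m n p k} {y : Fin (n + m)} {us : Vec (Term (n + m)) k} {u : Term m} {ts es Γ L c s} →
               u ⟶β* lams n (apps (var y) us) → (H : HnfTyping n p y ts es Γ L c s) →
               SpineSimulation {p} (HnfTyping.Δ₁ H) us (HnfTyping.Mcs₁ H) (HnfTyping.k₁ H) →
               EtaSimulation (λ j → F.opposite j ↑ˡ (n + m)) (HnfTyping.Δ₂ H) (HnfTyping.Mcs₂ H) (HnfTyping.k₂ H) →
               Simulation u Γ L c
simulate-hnf {n = n} {y = y} {Γ = Γ} redU (hnfTyping {Ns} {Ps} {T} {Mcs₁ = Mcs₁} {Mcs₂} eL _ _ eΔ refl _)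
             (spineSimulation {G} {D} {Mcs₁'} {k'} {_} {dE₁} {dT₁} spU refl wE₁ wS₁ le₁)
             (etaSimulation {Bs} {Mcs₂'} {dT₂} {dW} refl wS₂ wArrows le₂)
  with hnf-env-split y Ps Ns Γ _ D Bs eΔ
... | ePs , eNsΓ with splitAt n (single y ((Mcs₁' ⇛ Mcs₂' ⇛ T) ∷ []) ⊕ G)
... | Ns' , Γ' , eqS with ⊩-⟵β* redU (⊩-lams n Ns' (⊩-castE eqS (⊩-apps (ax y _) spU)))
... | _ , dU with WhE-++-inv Ns' (subst (λ X → WhE negv _ X (Ns ++ Γ)) eqS (WhE-respʳ-≈ wHead (≈E-sym eNsΓ)))
  where
  wHead : WhE negv _ (single y ((Mcs₁' ⇛ Mcs₂' ⇛ T) ∷ []) ⊕ G) (single y ((Mcs₁ ⇛ Mcs₂ ⇛ T) ∷ []) ⊕ D)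
  wHead = WhE-⊕ (WhE-single y (WhM-∷ (Wh-⇛ wS₁ (Wh-⇛ wS₂ (Wh-refl negv T))) (WhM-refl negv []))) wE₁
... | kA , kB , wNs , wΓ , eqK =
  simulation dU wΓ (Wh-respʳ-≈ (Wh-absType wNs wTail) (≈T-sym eL)) (cost-hnf {k'} {kA} {kB} {dW} {dT₁} {dT₂} {dE₁} eqK le₁ le₂)
  where
  wTail : Wh pos _ (Mcs₂' ⇛ T) (absType Ps T)
  wTail = Wh-respʳ-≈ (wArrows T)
            (≈T-trans (≈T-reflexive (sym (absType-opposite Bs T))) (absType-cong (≈E-sym ePs) (≈T-refl T)))

cost-⊕ : ∀ {a b c d e f x y} → a + (c + e) ≤ x → b + (d + f) ≤ y → (a + b) + ((c + d) + (e + f)) ≤ x + y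
cost-⊕ {a} {b} {c} {d} {e} {f} le₁ le₂ = ≤-trans (≤-reflexive (regroup a b c d e f)) (+-mono-≤ le₁ le₂)
  where
  regroup : ∀ a b c d e f → (a + b) + ((c + d) + (e + f)) ≡ (a + (c + e)) + (b + (d + f))
  regroup = solve-∀

cost-spine-∷ : ∀ {a b w c d e f x y} → a + (c + e) ≤ x → b + (d + f) ≤ y →
               (a + b + w) + ((c + d) + (e + f)) ≤ x + y + w
cost-spine-∷ {a} {b} {w} {c} {d} {e} {f} le₁ le₂ =
  ≤-trans (≤-reflexive (regroup a b w (c + d) (e + f))) (+-mono-≤ (cost-⊕ {a} {b} {c} {d} {e} {f} le₁ le₂) (≤-refl {w}))
  where
  regroup : ∀ a b w x y → (a + b + w) + (x + y) ≡ (a + b) + (x + y) + w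
  regroup = solve-∀

cost-η-∷ : ∀ {t tr e wr w x y} → e + t ≤ x → tr + wr ≤ y → (t + tr) + (e + wr + w) ≤ x + y + w
cost-η-∷ {t} {tr} {e} {wr} {w} le₁ le₂ =
  ≤-trans (≤-reflexive (regroup t tr e wr w)) (+-mono-≤ (+-mono-≤ le₁ le₂) (≤-refl {w}))
  where
  regroup : ∀ t tr e wr w → (t + tr) + (e + wr + w) ≡ (e + t) + (tr + wr) + w
  regroup = solve-∀

-- The recursion is on the size of the typing of t, bounded by the fuel b.
module Simulate (R : TRel) (R-post : ∀ {m} {t u : Term m} → R t u → BηF R t u) where

  simulate : ∀ b {m} {t u : Term m} {Γ L k s} → R t u → Γ ⊩ t ∶ L [ k , s ] → s < b → Simulation u Γ L k
  simulateM : ∀ b {m} {t u : Term m} {Γ M k s} → R t u → Γ ⊩M t ∶ M [ k , s ] → s < b → SimulationM u Γ M k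
  simulate-spine : ∀ b {p n k} {Δ : Env (p + n)} {ts : Vec (Term (p + n)) k} {us : Vec (Term n) k} {Mcs c s} →
                   Spine Δ ts Mcs c s → s ≤ b → (∀ i → R (lookup ts i) (wk p (lookup us i))) →
                   SpineSimulation {p} Δ us Mcs c
  simulate-η-spine : ∀ b {n q} {Δ : Env n} {es : Vec (Term n) q} {Mcs c s} (f : Fin q → Fin n) →
                     Spine Δ es Mcs c s → s ≤ b → (∀ j → R (lookup es j) (var (f j))) → EtaSimulation f Δ Mcs c

  simulate (suc b) r D (s≤s lt) with R-post r
  ... | inj₁ noHNF = ⊥-elim (noHNF (⊩⇒hasHNF D))
  ... | inj₂ (n , p , _ , y , us , ts , es , redT , redU , rts , res) with ⊩-⟶β* redT D
  ... | _ , le , D' with ⊩-hnf-inv n p y ts es D'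
  ... | H = simulate-hnf redU H
              (simulate-spine b {us = us} (HnfTyping.sp₁ H) (m+n≤o⇒m≤o _ bound) rts)
              (simulate-η-spine b (λ j → F.opposite j ↑ˡ _) (HnfTyping.sp₂ H) (m+n≤o⇒n≤o _ bound) res)
    where
    bound : HnfTyping.s₁ H + HnfTyping.s₂ H ≤ b
    bound = ≤-trans (HnfTyping.le H) (≤-trans le lt)

  simulateM b r mnil lt = simulationM mnil (WhE-refl negv ∅) (WhM-refl pos []) z≤n
  simulateM b r (mcons {s₁ = s₁} {s₂} D Ds) lt
    with simulate b r D (m+n≤o⇒m≤o (suc s₁) lt) | simulateM b r Ds (≤-trans (s≤s (m≤n+m s₂ s₁)) lt)
  ... | simulation {k' = a} {dE = c} {dT = e} d wE wT le | simulationM {k' = b'} {dE = d'} {dT = f} ds wE' wT' le' =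
    simulationM (mcons d ds) (WhE-⊕ wE wE') (WhM-∷ wT wT') (cost-⊕ {a} {b'} {c} {d'} {e} {f} le le')

  simulate-spine b {p} {us = []} [] lt rel = spineSimulation [] (sym (∅++∅ p)) (WhE-refl negv ∅) [] z≤n
  simulate-spine b {p} {us = u ∷ us} (_∷_ {c = col} {s₁ = s₁} d sp) lt rel
    with simulateM b (rel F.zero) d (m+n≤o⇒m≤o (suc s₁) lt) | simulate-spine b sp (m+n≤o⇒n≤o (suc s₁) lt) (λ i → rel (F.suc i))
  ... | simulationM {k' = a} {dE = c} {dT = e} d' wE wT le
      | spineSimulation {D = Dr} {k' = b'} {dE = d₀} {dT = f} sp' refl wE' wS' le'
    with ⊩M-wk-inv p u d'
  ... | G , _ , dG , eG with WhE-∅++-inv {p} (WhE-respˡ-≈ (≈E-sym eG) wE)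
  ... | D₁ , refl , wE₁ =
    spineSimulation (dG ∷ sp') (≡-trans (++-⊕ ∅ ∅ D₁ Dr) (cong (_++ (D₁ ⊕ Dr)) ∅⊕∅)) (WhE-⊕ wE₁ wE') (wT ∷ wS')
      (cost-spine-∷ {a} {b'} {whiteCost col} {c} {d₀} {e} {f} le le')

  simulate-η-spine b f [] lt rel = etaSimulation {Bs = []} refl [] (Wh-refl pos) z≤n
  simulate-η-spine b f (_∷_ {c = col} {s₁ = s₁} d sp) lt rel
    with simulateM b (rel F.zero) d (m+n≤o⇒m≤o (suc s₁) lt)
       | simulate-η-spine b (λ j → f (F.suc j)) sp (m+n≤o⇒n≤o (suc s₁) lt) (λ j → rel (F.suc j))
  ... | simulationM {M' = M'} {dE = dE} {dT = dT} d' wE wT le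
      | etaSimulation {Bs = Bs} {Mcs' = Mcs'} {dT = dTr} {dW = dWr} refl wS' wArrows' le'
    with ⊩M-var-inv d'
  ... | refl , refl , eV with WhE-single-inv (f F.zero) (WhE-respˡ-≈ (≈E-sym eV) wE)
  ... | B , refl , wB =
    etaSimulation {Bs = B ∷ Bs} {Mcs' = (M' , col) ∷ Mcs'} refl (wT ∷ wS') (wArrows col)
      (cost-η-∷ {dT} {dTr} {dE} {dWr} {whiteCost col} le le')
    where
    wArrows : ∀ col T → Wh pos (dE + dWr + whiteCost col) (((M' , col) ∷ Mcs') ⇛ T) ((B ∷ Bs) ⇛• T)
    wArrows white T = whten wB (wArrows' T)
    wArrows black T = Wh-cast (sym (+-identityʳ _)) (same wB (wArrows' T))

corollary1 : ∀ {n} (t u : Term n) → t ⊑Bηred u → t ⊑pwc u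
corollary1 t u (R , R-post , r) Γ L k D with ⊢•⇒⊩ D t refl
... | s , d with Simulate.simulate R R-post (suc s) r d ≤-refl
... | simulation {Γ'} {L'} {k'} {_} {dE} {dT} d' wE wT le =
  Γ' , L' , k' , dE + dT , ⊩⇒⊢• d' , (dE , dT , refl , wE , wT) , le
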